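{- Let $i$ be a positive integer, let $D$ be an $(i,2)$ digraph, and let $H$ be a hole of length $l$ in the underlying graph $U(D)$. If $l \geq 3i+1$, then the subgraph of the phylogeny graph $P(D)$ induced by $V(H)$ contains a hole. Furthermore, for every integer $i \geq 2$ there exists an $(i,2)$ digraph $D$ and a hole $H$ of length $l = 3i$ in $U(D)$ such that the subgraph of $P(D)$ induced by $V(H)$ contains no hole.
   Context: All graphs and digraphs are finite and simple. For positive integers $i,j$, an $(i,j)$ digraph is an acyclic digraph in which every vertex has indegree at most $i$ and outdegree at most $j$. The underlying graph $U(D)$ of a digraph $D$ has vertex set $V(D)$ and an edge $uv$ whenever $(u,v)\in A(D)$ or $(v,u)\in A(D)$. The phylogeny graph $P(D)$ of an acyclic digraph $D$ has vertex set $V(D)$ and an edge between distinct $u,v$ if and only if $(u,v)\in A(D)$, or $(v,u)\in A(D)$, or there is $w\in V(D)$ with $(u,w),(v,w)\in A(D)$. A hole in a graph is an induced subgraph that is a cycle of length at least $4$ (a chordless cycle of length at least 4). -}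

module Defs where

open import Data.Nat using (ℕ; zero; suc; _+_; _≤_)
open import Data.Bool using (Bool; true; false; T; if_then_else_)
open import Data.Fin using (Fin; toℕ)
open import Data.List using (List; map)
open import Data.Nat.ListAction using (sum)
open import Data.List.Base using () renaming (allFin to allFinL)
open import Data.Product using (Σ; ∃; _×_; _,_)
open import Data.Sum using (_⊎_)
open import Relation.Binary.PropositionalEquality using (_≡_; _≢_)
open import Relation.Binary.Construct.Closure.Transitive using (TransClosure)
open import Relation.Nullary using (¬_)
open import Function.Definitions using (Injective)

Digraph : ℕ → Set
Digraph n = Fin n → Fin n → Bool

Arc : ∀ {n} → Digraph n → Fin n → Fin n → Set
Arc D u v = T (D u v)

Acyclic : ∀ {n} → Digraph n → Set
Acyclic {n} D = (v : Fin n) → ¬ TransClosure (Arc D) v v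

countB : ∀ {n} → (Fin n → Bool) → ℕ
countB {n} p = sum (map (λ u → if p u then 1 else 0) (allFinL n))

indeg : ∀ {n} → Digraph n → Fin n → ℕ
indeg D v = countB (λ u → D u v)

outdeg : ∀ {n} → Digraph n → Fin n → ℕ
outdeg D v = countB (λ w → D v w)

IsIJDigraph : ∀ {n} → ℕ → ℕ → Digraph n → Set
IsIJDigraph {n} i j D =
  Acyclic D × ((v : Fin n) → indeg D v ≤ i) × ((v : Fin n) → outdeg D v ≤ j)

Graph : ℕ → Set₁
Graph n = Fin n → Fin n → Set

U : ∀ {n} → Digraph n → Graph n
U D u v = Arc D u v ⊎ Arc D v u

P : ∀ {n} → Digraph n → Graph n
P {n} D u v =
  u ≢ v × (Arc D u v ⊎ Arc D v u ⊎ Σ (Fin n) (λ w → Arc D u w × Arc D v w))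

CycAdj : (l : ℕ) → Fin l → Fin l → Set
CycAdj l j k =
  suc (toℕ j) ≡ toℕ k ⊎ suc (toℕ k) ≡ toℕ j
  ⊎ (suc (toℕ j) ≡ l × toℕ k ≡ 0) ⊎ (suc (toℕ k) ≡ l × toℕ j ≡ 0)

-- H : Fin l → Fin n lists the vertices of a hole of length l in G, in cyclic order:
-- l ≥ 4, the vertices are distinct, and two distinct vertices of H are adjacent in G
-- exactly when they are consecutive on the cycle (i.e. the cycle is induced / chordless).
IsHole : ∀ {n} → Graph n → (l : ℕ) → (Fin l → Fin n) → Set
IsHole G l H =
  4 ≤ l × Injective _≡_ _≡_ H
  × (∀ j k → j ≢ k → (G (H j) (H k) → CycAdj l j k) × (CycAdj l j k → G (H j) (H k)))

-- the subgraph of G induced by the vertex set V(H) contains a hole: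
-- some hole of G has all of its vertices in V(H)
-- (a hole of G[V(H)] is exactly a hole of G with vertices in V(H)).
InducedContainsHole : ∀ {n} → Graph n → ∀ {l} → (Fin l → Fin n) → Set
InducedContainsHole {n} G {l} H =
  Σ ℕ λ m → Σ (Fin m → Fin n) λ W →
    IsHole G m W × ((k : Fin m) → Σ (Fin l) λ j → H j ≡ W k)

module Submission where

-- Since D is acyclic, the hole H has a source and a sink along its cycle; a sink has two
-- in-neighbours on H, so i ≥ 2. Rotate H so that its vertex 0 is a source. Consecutive non-sinks of H
-- are adjacent in P(D), directly or through the sink between them; let first and last be the non-sinks
-- next to 0. If they are not adjacent in P(D), then 0 and the non-sinks from first to last contain a
-- hole. Otherwise first and last have a common out-neighbour w off H. A non-sink of H has an
-- out-neighbour on H, hence at most one off H, so a non-sink pointing to w is adjacent in P(D) to a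
-- non-sink far away on H only if that one points to w as well. If, among the non-sinks pointing to w,
-- some q is followed by the next one only after two further non-sinks, then q and the non-sinks from
-- the successor of q to that next one contain a hole. Otherwise each of these at most indeg w ≤ i
-- vertices accounts for a block of three consecutive positions of H (itself, the following position
-- and its out-neighbour on H), the blocks cover all l positions, and l ≤ 3i.
--
-- On a cycle of length 3i let the vertices 3j be sources and the vertices 3j + 2 sinks, and
-- let each 3j + 1 also point to an extra vertex w. Vertices without out-arcs are simplicial in P(D),
-- and once they are removed every source is adjacent only to vertices pointing to w, which form a
-- clique; this elimination ordering shows that P(D) has no hole at all.

open import Defs
open import Data.Bool using (Bool; true; false; T; if_then_else_)
open import Data.Empty using (⊥; ⊥-elim)
open import Data.Fin as Fin using (Fin; toℕ; fromℕ)
open import Data.Fin.Properties using (toℕ-injective; toℕ-fromℕ; toℕ-fromℕ<; toℕ<n; any?)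
import Data.Fin.Properties as Finₚ
open import Data.List using (List; []; _∷_; length; map; filter; lookup; applyUpTo)
open import Data.List.Base using () renaming (allFin to allFinL)
open import Data.List.Extrema.Nat using (argmin; f[argmin]≤f[xs])
open import Data.List.Membership.Propositional using (_∈_; _∉_)
open import Data.List.Membership.Propositional.Properties
  using (∈-allFin; ∈-filter⁺; ∈-filter⁻; ∈-map⁻; ∈-lookup; ∈-applyUpTo⁺)
open import Data.List.Properties using (length-removeAt′; length-map; length-applyUpTo)
open import Data.List.Relation.Binary.Subset.Propositional using (_⊆_)
open import Data.List.Relation.Binary.Subset.Propositional.Properties using (⊆-trans)
open import Data.List.Relation.Unary.All as All using (All; []; _∷_)
import Data.List.Relation.Unary.All.Properties as Allₚ
open import Data.List.Relation.Unary.AllPairs using (AllPairs; []; _∷_)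
open import Data.List.Relation.Unary.Any as Any using (Any; here; there; _─_)
open import Data.List.Relation.Unary.Unique.Propositional using (Unique)
import Data.List.Relation.Unary.Unique.Propositional.Properties as Uniqueₚ
open import Data.Nat
  using (ℕ; zero; suc; _+_; _*_; _∸_; _≤_; _<_; z≤n; s≤s; pred; _%_; _≟_; _<?_; _≤?_; >-nonZero)
open import Data.Nat.DivMod
  using (_mod_; m%n<n; n%n≡0; m%n%n≡m%n; %-distribˡ-+; [m+n]%n≡m%n; [m+kn]%n≡m%n; m<n⇒m%n≡m)
open import Data.Nat.Induction using (<-wellFounded)
open import Data.Nat.ListAction using (sum)
open import Data.Nat.Properties
open import Data.List.Membership.DecPropositional _≟_ using (_∈?_)
open import Data.Product using (Σ; ∃; _×_; _,_; proj₁; proj₂)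
open import Data.Sum using (_⊎_; inj₁; inj₂; swap)
import Data.Sum as Sum
open import Function using (_∘_; id)
open import Function.Bundles using (_⇔_; mk⇔; Equivalence)
open import Induction.WellFounded using (Acc; acc)
open import Relation.Binary using (tri<; tri≈; tri>)
open import Relation.Binary.Construct.Closure.Transitive using (TransClosure; [_]; _∷_; _∷ʳ_)
open import Relation.Binary.PropositionalEquality
open import Relation.Nullary using (¬_; Dec; yes; no; contradiction; ¬?)
open import Relation.Nullary.Decidable
  using (T?; _×-dec_; _⊎-dec_; decidable-stable; ⌊_⌋; toWitness; fromWitness)

open Equivalence using (to; from)

module _ {a} {A : Set a} where

  ∈-─ : ∀ {x y} {ys : List A} (x∈ys : x ∈ ys) → y ∈ ys → y ≢ x → y ∈ (ys ─ x∈ys)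
  ∈-─ (here refl) (here refl) y≢x = contradiction refl y≢x
  ∈-─ (here _)    (there y∈)  _   = y∈
  ∈-─ (there _)   (here refl) _   = here refl
  ∈-─ (there x∈)  (there y∈)  y≢x = there (∈-─ x∈ y∈ y≢x)

  Unique⇒length≤ : ∀ {xs ys : List A} → Unique xs → xs ⊆ ys → length xs ≤ length ys
  Unique⇒length≤ {[]}     _               _     = z≤n
  Unique⇒length≤ {x ∷ xs} {ys} (x∉xs ∷ !xs) xs⊆ys = begin
    suc (length xs)           ≤⟨ s≤s (Unique⇒length≤ !xs xs⊆ys─x) ⟩
    suc (length (ys ─ x∈ys))  ≡⟨ length-removeAt′ ys _ ⟨
    length ys                 ∎
    where
    open ≤-Reasoning
    x∈ys : x ∈ ys
    x∈ys = xs⊆ys (here refl)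
    xs⊆ys─x : xs ⊆ (ys ─ x∈ys)
    xs⊆ys─x z∈xs = ∈-─ x∈ys (xs⊆ys (there z∈xs)) λ { refl → All.lookup x∉xs z∈xs refl }

module _ {n} (p : Fin n → Bool) where

  private
    satisfying : List (Fin n)
    satisfying = filter (T? ∘ p) (allFinL n)

    count-filter : ∀ xs → sum (map (λ u → if p u then 1 else 0) xs) ≡ length (filter (T? ∘ p) xs)
    count-filter []       = refl
    count-filter (x ∷ xs) with p x
    ... | true  = cong suc (count-filter xs)
    ... | false = count-filter xs

    countB≡ : countB p ≡ length satisfying
    countB≡ = count-filter (allFinL n)

  length≤countB : ∀ {xs} → Unique xs → All (T ∘ p) xs → length xs ≤ countB p
  length≤countB {xs} !xs pxs = subst (length xs ≤_) (sym countB≡)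
    (Unique⇒length≤ !xs λ {u} u∈xs → ∈-filter⁺ (T? ∘ p) (∈-allFin u) (All.lookup pxs u∈xs))

  countB≤length : ∀ {ys : List ℕ} → (∀ u → T (p u) → toℕ u ∈ ys) → countB p ≤ length ys
  countB≤length {ys} ys-complete = begin
    countB p                   ≡⟨ countB≡ ⟩
    length satisfying          ≡⟨ length-map toℕ satisfying ⟨
    length (map toℕ satisfying) ≤⟨ Unique⇒length≤ !toℕs toℕs⊆ys ⟩
    length ys                  ∎
    where
    open ≤-Reasoning
    !toℕs : Unique (map toℕ satisfying)
    !toℕs = Uniqueₚ.map⁺ toℕ-injective (Uniqueₚ.filter⁺ (T? ∘ p) (Uniqueₚ.allFin⁺ n))
    toℕs⊆ys : map toℕ satisfying ⊆ ys
    toℕs⊆ys k∈ with ∈-map⁻ toℕ k∈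
    ... | u , u∈ , refl = ys-complete u (proj₂ (∈-filter⁻ (T? ∘ p) {xs = allFinL n} u∈))

rise : ∀ {p} {Q : ℕ → Set p} → (∀ x → Dec (Q x)) →
  ∀ {k m} → k ≤ m → ¬ Q k → Q m → ∃ λ r → ¬ Q r × Q (suc r)
rise Q? {m = zero}  z≤n ¬Qk Qm = contradiction Qm ¬Qk
rise Q? {m = suc m} k≤1+m ¬Qk Q1+m with Q? m
... | no ¬Qm = m , ¬Qm , Q1+m
... | yes Qm with m≤n⇒m<n∨m≡n k≤1+m
...   | inj₁ k<1+m = rise Q? (≤-pred k<1+m) ¬Qk Qm
...   | inj₂ refl  = contradiction Q1+m ¬Qk

fall : ∀ {p} {Q : ℕ → Set p} → (∀ x → Dec (Q x)) →
  ∀ {k m} → k ≤ m → Q k → ¬ Q m → ∃ λ r → Q r × ¬ Q (suc r)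
fall Q? k≤m Qk ¬Qm =
  let (r , ¬¬Qr , ¬Q1+r) = rise (¬? ∘ Q?) k≤m (λ ¬Qk → ¬Qk Qk) ¬Qm
  in r , decidable-stable (Q? r) ¬¬Qr , ¬Q1+r

least-above : ∀ {p} {Q : ℕ → Set p} → (∀ x → Dec (Q x)) → ∀ {q e} → q < e → Q e →
  ∃ λ q′ → q < q′ × q′ ≤ e × Q q′ × (∀ z → q < z → z < q′ → ¬ Q z)
least-above {Q = Q} Q? {q} q<e Qe = go (<-wellFounded _) q<e Qe
  where
  go : ∀ {e} → Acc _<_ e → q < e → Q e →
    ∃ λ q′ → q < q′ × q′ ≤ e × Q q′ × (∀ z → q < z → z < q′ → ¬ Q z)
  go {e} (acc rec) q<e Qe with anyUpTo? (λ z → (q <? z) ×-dec Q? z) e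
  ... | yes (z , z<e , q<z , Qz) =
    let (q′ , q<q′ , q′≤z , Qq′ , least) = go (rec z<e) q<z Qz
    in q′ , q<q′ , ≤-trans q′≤z (<⇒≤ z<e) , Qq′ , least
  ... | no none = e , q<e , ≤-refl , Qe , λ z q<z z<e Qz → none (z , z<e , q<z , Qz)

-- Holes from induced paths

CycAdj-sym : ∀ {m} {j k : Fin m} → CycAdj m j k → CycAdj m k j
CycAdj-sym (inj₁ e)               = inj₂ (inj₁ e)
CycAdj-sym (inj₂ (inj₁ e))        = inj₁ e
CycAdj-sym (inj₂ (inj₂ (inj₁ e))) = inj₂ (inj₂ (inj₂ e))
CycAdj-sym (inj₂ (inj₂ (inj₂ e))) = inj₂ (inj₂ (inj₁ e))

CycAdj-< : ∀ {m} {j k : Fin m} → toℕ j < toℕ k →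
  CycAdj m j k ⇔ (suc (toℕ j) ≡ toℕ k ⊎ (toℕ j ≡ 0 × suc (toℕ k) ≡ m))
CycAdj-< {m} {j} {k} j<k = mk⇔ forth back
  where
  forth : CycAdj m j k → suc (toℕ j) ≡ toℕ k ⊎ (toℕ j ≡ 0 × suc (toℕ k) ≡ m)
  forth (inj₁ e)                    = inj₁ e
  forth (inj₂ (inj₁ e))             = contradiction (subst (_< toℕ k) (sym e) j<k) (<-asym (n<1+n (toℕ k)))
  forth (inj₂ (inj₂ (inj₁ (_ , e)))) = contradiction (subst (toℕ j <_) e j<k) n≮0
  forth (inj₂ (inj₂ (inj₂ (e , z)))) = inj₂ (z , e)
  back : suc (toℕ j) ≡ toℕ k ⊎ (toℕ j ≡ 0 × suc (toℕ k) ≡ m) → CycAdj m j k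
  back (inj₁ e)       = inj₁ e
  back (inj₂ (z , e)) = inj₂ (inj₂ (inj₂ (e , z)))

module _ {n} {G : Graph n} (G-sym : ∀ {u v} → G u v → G v u) where

  IsHole-from-< : ∀ {m} {W : Fin m → Fin n} → 4 ≤ m →
    (∀ j k → toℕ j < toℕ k → (G (W j) (W k) ⇔ CycAdj m j k) × W j ≢ W k) → IsHole G m W
  IsHole-from-< {m} {W} 4≤m ordered = 4≤m , injective , adjacency
    where
    injective : ∀ {j k} → W j ≡ W k → j ≡ k
    injective {j} {k} e with <-cmp (toℕ j) (toℕ k)
    ... | tri< j<k _ _ = contradiction e (proj₂ (ordered j k j<k))
    ... | tri≈ _ j≡k _ = toℕ-injective j≡k
    ... | tri> _ _ k<j = contradiction (sym e) (proj₂ (ordered k j k<j))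
    adjacency : ∀ j k → j ≢ k → (G (W j) (W k) → CycAdj m j k) × (CycAdj m j k → G (W j) (W k))
    adjacency j k j≢k with <-cmp (toℕ j) (toℕ k)
    ... | tri< j<k _ _ = to (proj₁ (ordered j k j<k)) , from (proj₁ (ordered j k j<k))
    ... | tri≈ _ j≡k _ = contradiction (toℕ-injective j≡k) j≢k
    ... | tri> _ _ k<j = CycAdj-sym ∘ to (proj₁ (ordered k j k<j)) ∘ G-sym
                       , G-sym ∘ from (proj₁ (ordered k j k<j)) ∘ CycAdj-sym

Walk : ∀ {n} → Graph n → Fin n → List (Fin n) → Fin n → Set
Walk G u []       v = u ≡ v
Walk G u (z ∷ zs) v = G u z × Walk G z zs v

InducedPath : ∀ {n} → Graph n → Fin n → List (Fin n) → Fin n → Set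
InducedPath G u []       v = u ≡ v
InducedPath G u (z ∷ zs) v =
  G u z × u ≢ z × All (λ y → y ≢ u × ¬ G u y) zs × InducedPath G z zs v

module _ {n} {G : Graph n} where

  InducedPath-last : ∀ {u} ys {v} → InducedPath G u ys v →
    ∀ (k : Fin (suc (length ys))) → toℕ k ≡ length ys → lookup (u ∷ ys) k ≡ v
  InducedPath-last []       u≡v       Fin.zero    _ = u≡v
  InducedPath-last (y ∷ ys) (_ , _ , _ , path) (Fin.suc k) e = InducedPath-last ys path k (suc-injective e)

  InducedPath-lookup : ∀ {u} ys {v} → InducedPath G u ys v →
    ∀ (j k : Fin (suc (length ys))) → toℕ j < toℕ k →
    (G (lookup (u ∷ ys) j) (lookup (u ∷ ys) k) ⇔ suc (toℕ j) ≡ toℕ k)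
    × lookup (u ∷ ys) j ≢ lookup (u ∷ ys) k
  InducedPath-lookup (y ∷ ys) (uy , u≢y , _ , _) Fin.zero (Fin.suc Fin.zero) _ =
    mk⇔ (λ _ → refl) (λ _ → uy) , u≢y
  InducedPath-lookup {u} (y ∷ ys) (_ , _ , far , _) Fin.zero (Fin.suc (Fin.suc k)) _ =
    mk⇔ (λ g → contradiction g (proj₂ far-k)) (λ ()) , ≢-sym (proj₁ far-k)
    where
    far-k : lookup ys k ≢ u × ¬ G u (lookup ys k)
    far-k = All.lookup far (∈-lookup k)
  InducedPath-lookup (y ∷ ys) (_ , _ , _ , path) (Fin.suc j) (Fin.suc k) (s≤s j<k) =
    let (adj , distinct) = InducedPath-lookup ys path j k j<k
    in mk⇔ (cong suc ∘ to adj) (from adj ∘ suc-injective) , distinct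

module _ {n} {G : Graph n} (G? : ∀ u v → Dec (G u v))
         (G-sym : ∀ {u v} → G u v → G v u) (G-irrefl : ∀ {u} → ¬ G u u) where

  private
    AtOrNext : Fin n → Fin n → Set
    AtOrNext u y = y ≡ u ⊎ G u y

    AtOrNext? : ∀ u y → Dec (AtOrNext u y)
    AtOrNext? u y = (y Fin.≟ u) ⊎-dec G? u y

    -- u is joined to the last vertex of the path that is u itself or a neighbour of u
    shortcut : ∀ {u y} ys {v} → Any (AtOrNext u) (y ∷ ys) → InducedPath G y ys v →
      Σ (List (Fin n)) λ ws → InducedPath G u ws v × ws ⊆ y ∷ ys
    shortcut {u} ys hit path with Any.any? (AtOrNext? u) ys
    shortcut (_ ∷ ys) _ (_ , _ , _ , path) | yes later =
      let (ws , path′ , ws⊆) = shortcut ys later path in ws , path′ , there ∘ ws⊆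
    shortcut ys (there later)          _    | no none = contradiction later none
    shortcut ys (here (inj₁ refl))     path | no none = ys , path , there
    shortcut {u} {y} ys (here (inj₂ uy)) path | no none =
      y ∷ ys , (uy , (λ { refl → G-irrefl uy }) , All.map split (Allₚ.¬Any⇒All¬ ys none) , path) , id
      where
      split : ∀ {z} → ¬ AtOrNext u z → z ≢ u × ¬ G u z
      split ¬at = ¬at ∘ inj₁ , ¬at ∘ inj₂

  induced-subwalk : ∀ {u} zs {v} → Walk G u zs v →
    Σ (List (Fin n)) λ ws → InducedPath G u ws v × ws ⊆ zs
  induced-subwalk []       u≡v       = [] , u≡v , λ ()
  induced-subwalk (z ∷ zs) (uz , walk) =
    let (ys , path , ys⊆zs) = induced-subwalk zs walk
        (ws , path′ , ws⊆)  = shortcut ys (here (inj₂ uz)) path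
    in ws , path′ , ⊆-trans ws⊆ λ { (here e) → here e ; (there y∈) → there (ys⊆zs y∈) }

  apex-hole : ∀ {x a} ys {b} → InducedPath G a ys b → G x a → G x b → a ≢ b → ¬ G a b → x ∉ ys →
    (∀ {y} → y ∈ ys → y ≢ b → ¬ G x y) → IsHole G (suc (suc (length ys))) (lookup (x ∷ a ∷ ys))
  apex-hole {x} {a} ys {b} path xa xb a≢b ¬ab x∉ys inner-far = IsHole-from-< {G = G} G-sym (long ys path) ordered
    where
    m : ℕ
    m = suc (suc (length ys))

    long : ∀ ys → InducedPath G a ys b → 4 ≤ suc (suc (length ys))
    long []          a≡b                 = contradiction a≡b a≢b
    long (y ∷ [])    (ay , _ , _ , refl) = contradiction ay ¬ab
    long (_ ∷ _ ∷ _) _                   = s≤s (s≤s (s≤s (s≤s z≤n)))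

    inner≢b : ∀ (k : Fin (length ys)) → suc (toℕ k) ≢ length ys → lookup ys k ≢ b
    inner≢b k ¬last = subst (lookup ys k ≢_) (InducedPath-last ys path (fromℕ (length ys)) (toℕ-fromℕ _))
      (proj₂ (InducedPath-lookup ys path (Fin.suc k) (fromℕ (length ys))
        (subst (suc (toℕ k) <_) (sym (toℕ-fromℕ _)) (≤∧≢⇒< (toℕ<n k) ¬last))))

    apex : ∀ k → (G x (lookup (a ∷ ys) k) ⇔ (toℕ k ≡ 0 ⊎ toℕ k ≡ length ys)) × x ≢ lookup (a ∷ ys) k
    apex Fin.zero    = mk⇔ (λ _ → inj₁ refl) (λ _ → xa) , λ { refl → G-irrefl xa }
    apex (Fin.suc k) with suc (toℕ k) ≟ length ys
    ... | yes last = mk⇔ (λ _ → inj₂ last) (λ _ → subst (G x) (sym (InducedPath-last ys path (Fin.suc k) last)) xb)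
                   , λ { refl → x∉ys (∈-lookup k) }
    ... | no ¬last = mk⇔ (λ g → contradiction g (inner-far (∈-lookup k) (inner≢b k ¬last)))
                         (λ { (inj₁ ()) ; (inj₂ e) → contradiction e ¬last })
                   , λ { refl → x∉ys (∈-lookup k) }

    ordered : ∀ j k → toℕ j < toℕ k →
      (G (lookup (x ∷ a ∷ ys) j) (lookup (x ∷ a ∷ ys) k) ⇔ CycAdj m j k)
      × lookup (x ∷ a ∷ ys) j ≢ lookup (x ∷ a ∷ ys) k
    ordered Fin.zero (Fin.suc k) 0<k =
      mk⇔ (from (CycAdj-< 0<k) ∘ forth ∘ to (proj₁ (apex k)))
          (from (proj₁ (apex k)) ∘ back ∘ to (CycAdj-< 0<k))
      , proj₂ (apex k)
      where
      forth : toℕ k ≡ 0 ⊎ toℕ k ≡ length ys → 1 ≡ suc (toℕ k) ⊎ (0 ≡ 0 × suc (suc (toℕ k)) ≡ m)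
      forth (inj₁ k≡0)    = inj₁ (cong suc (sym k≡0))
      forth (inj₂ k≡last) = inj₂ (refl , cong (suc ∘ suc) k≡last)
      back : 1 ≡ suc (toℕ k) ⊎ (0 ≡ 0 × suc (suc (toℕ k)) ≡ m) → toℕ k ≡ 0 ⊎ toℕ k ≡ length ys
      back (inj₁ e)       = inj₁ (sym (suc-injective e))
      back (inj₂ (_ , e)) = inj₂ (suc-injective (suc-injective e))
    ordered (Fin.suc j) (Fin.suc k) (s≤s j<k) =
      mk⇔ (from (CycAdj-< (s≤s j<k)) ∘ inj₁ ∘ cong suc ∘ to adj)
          (from adj ∘ back ∘ to (CycAdj-< (s≤s j<k)))
      , distinct
      where
      adj : G (lookup (a ∷ ys) j) (lookup (a ∷ ys) k) ⇔ suc (toℕ j) ≡ toℕ k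
      adj = proj₁ (InducedPath-lookup ys path j k j<k)
      distinct : lookup (a ∷ ys) j ≢ lookup (a ∷ ys) k
      distinct = proj₂ (InducedPath-lookup ys path j k j<k)
      back : suc (suc (toℕ j)) ≡ suc (toℕ k) ⊎ (suc (toℕ j) ≡ 0 × suc (suc (toℕ k)) ≡ m) →
        suc (toℕ j) ≡ toℕ k
      back (inj₁ e) = suc-injective e
      back (inj₂ (() , _))

  hole-from-apex : ∀ {x a} zs {b} → Walk G a zs b → G x a → G x b → a ≢ b → ¬ G a b → x ∉ zs →
    (∀ {z} → z ∈ zs → z ≢ b → ¬ G x z) →
    Σ ℕ λ m → Σ (Fin m → Fin n) λ W → IsHole G m W × (∀ k → W k ∈ x ∷ a ∷ zs)
  hole-from-apex {x} {a} zs walk xa xb a≢b ¬ab x∉zs inner-far with induced-subwalk zs walk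
  ... | ys , path , ys⊆zs =
    _ , lookup (x ∷ a ∷ ys) , apex-hole ys path xa xb a≢b ¬ab (x∉zs ∘ ys⊆zs) (inner-far ∘ ys⊆zs) , inside
    where
    inside : ∀ k → lookup (x ∷ a ∷ ys) k ∈ x ∷ a ∷ zs
    inside Fin.zero              = here refl
    inside (Fin.suc Fin.zero)    = there (here refl)
    inside (Fin.suc (Fin.suc k)) = there (there (ys⊆zs (∈-lookup k)))

-- Indices modulo l, rotations of a hole, elimination orderings

module Cyclic (L : ℕ) where

  private
    l : ℕ
    l = suc L

  %-absorbˡ : ∀ x y → (x % l + y) % l ≡ (x + y) % l
  %-absorbˡ x y = begin
    (x % l + y) % l           ≡⟨ %-distribˡ-+ (x % l) y l ⟩
    (x % l % l + y % l) % l   ≡⟨ cong (λ t → (t + y % l) % l) (m%n%n≡m%n x l) ⟩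
    (x % l + y % l) % l       ≡⟨ %-distribˡ-+ x y l ⟨
    (x + y) % l               ∎
    where open ≡-Reasoning

  %-absorbʳ : ∀ x y → (x + y % l) % l ≡ (x + y) % l
  %-absorbʳ x y = begin
    (x + y % l) % l  ≡⟨ cong (_% l) (+-comm x (y % l)) ⟩
    (y % l + x) % l  ≡⟨ %-absorbˡ y x ⟩
    (y + x) % l      ≡⟨ cong (_% l) (+-comm y x) ⟩
    (x + y) % l      ∎
    where open ≡-Reasoning

  %-cancelʳ-+ : ∀ s x y → (x + s) % l ≡ (y + s) % l → x % l ≡ y % l
  %-cancelʳ-+ s x y e = trans (unshift x) (trans (cong (λ t → (t + s * L) % l) e) (sym (unshift y)))
    where
    unshift : ∀ z → z % l ≡ ((z + s) % l + s * L) % l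
    unshift z = begin
      z % l                    ≡⟨ [m+kn]%n≡m%n z s l ⟨
      (z + s * l) % l          ≡⟨ cong (λ t → (z + t) % l) (*-suc s L) ⟩
      (z + (s + s * L)) % l    ≡⟨ cong (_% l) (+-assoc z s (s * L)) ⟨
      (z + s + s * L) % l      ≡⟨ %-absorbˡ (z + s) (s * L) ⟨
      ((z + s) % l + s * L) % l ∎
      where open ≡-Reasoning

  Succ : ℕ → ℕ → Set
  Succ x y = suc x % l ≡ y % l

  Succ⇒ : ∀ {x y} → x < l → y < l → Succ x y → suc x ≡ y ⊎ (suc x ≡ l × y ≡ 0)
  Succ⇒ {x} {y} x<l y<l e with m≤n⇒m<n∨m≡n x<l
  ... | inj₁ 1+x<l = inj₁ (trans (sym (m<n⇒m%n≡m 1+x<l)) (trans e (m<n⇒m%n≡m y<l)))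
  ... | inj₂ 1+x≡l = inj₂ (1+x≡l , (begin
    y          ≡⟨ m<n⇒m%n≡m y<l ⟨
    y % l      ≡⟨ e ⟨
    suc x % l  ≡⟨ cong (_% l) 1+x≡l ⟩
    l % l      ≡⟨ n%n≡0 l ⟩
    0          ∎))
    where open ≡-Reasoning

  ⇒Succ : ∀ {x y} → suc x ≡ y ⊎ (suc x ≡ l × y ≡ 0) → Succ x y
  ⇒Succ (inj₁ refl)          = refl
  ⇒Succ (inj₂ (1+x≡l , refl)) = trans (cong (_% l) 1+x≡l) (n%n≡0 l)

  CycAdj⇔Succ : ∀ {j k : Fin l} → CycAdj l j k ⇔ (Succ (toℕ j) (toℕ k) ⊎ Succ (toℕ k) (toℕ j))
  CycAdj⇔Succ {j} {k} = mk⇔ forth back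
    where
    forth : CycAdj l j k → Succ (toℕ j) (toℕ k) ⊎ Succ (toℕ k) (toℕ j)
    forth (inj₁ e)               = inj₁ (⇒Succ (inj₁ e))
    forth (inj₂ (inj₁ e))        = inj₂ (⇒Succ (inj₁ e))
    forth (inj₂ (inj₂ (inj₁ e))) = inj₁ (⇒Succ (inj₂ e))
    forth (inj₂ (inj₂ (inj₂ e))) = inj₂ (⇒Succ (inj₂ e))
    back : Succ (toℕ j) (toℕ k) ⊎ Succ (toℕ k) (toℕ j) → CycAdj l j k
    back (inj₁ s) = Sum.map₂ (inj₂ ∘ inj₁) (Succ⇒ (toℕ<n j) (toℕ<n k) s)
    back (inj₂ s) = inj₂ (Sum.map₂ inj₂ (Succ⇒ (toℕ<n k) (toℕ<n j) s))

  Succ-+ : ∀ s x y → Succ x y ⇔ Succ (x + s) (y + s)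
  Succ-+ s x y = mk⇔ (λ e → trans (sym (%-absorbˡ (suc x) s)) (trans (cong (λ t → (t + s) % l) e) (%-absorbˡ y s)))
                         (%-cancelʳ-+ s (suc x) y)

  Succ-% : ∀ x y → Succ x y ⇔ Succ (x % l) (y % l)
  Succ-% x y = mk⇔ (λ e → trans (%-absorbʳ 1 x) (trans e (sym (m%n%n≡m%n y l))))
                       (λ e → trans (sym (%-absorbʳ 1 x)) (trans e (m%n%n≡m%n y l)))

  ¬Succ-refl : 2 ≤ L → ∀ x → ¬ Succ x x
  ¬Succ-refl 2≤L x e = 1+n≢0 (trans (sym (m<n⇒m%n≡m 1<l)) (%-cancelʳ-+ x 1 0 e))
    where
    1<l : 1 < l
    1<l = s≤s (≤-trans (s≤s z≤n) 2≤L)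

  toℕ-mod : ∀ x → toℕ (x mod l) ≡ x % l
  toℕ-mod x = toℕ-fromℕ< (m%n<n x l)

  rotate : ℕ → Fin l → Fin l
  rotate s k = (toℕ k + s) mod l

  rotate-mod : ∀ s x → rotate s (x mod l) ≡ (x + s) mod l
  rotate-mod s x = toℕ-injective (begin
    toℕ (rotate s (x mod l))   ≡⟨ toℕ-mod (toℕ (x mod l) + s) ⟩
    (toℕ (x mod l) + s) % l    ≡⟨ cong (λ t → (t + s) % l) (toℕ-mod x) ⟩
    (x % l + s) % l            ≡⟨ %-absorbˡ x s ⟩
    (x + s) % l                ≡⟨ toℕ-mod (x + s) ⟨
    toℕ ((x + s) mod l)        ∎)
    where open ≡-Reasoning

  rotate-injective : ∀ s {j k} → rotate s j ≡ rotate s k → j ≡ k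
  rotate-injective s {j} {k} e = toℕ-injective (begin
    toℕ j        ≡⟨ m<n⇒m%n≡m (toℕ<n j) ⟨
    toℕ j % l    ≡⟨ %-cancelʳ-+ s (toℕ j) (toℕ k) shifted ⟩
    toℕ k % l    ≡⟨ m<n⇒m%n≡m (toℕ<n k) ⟩
    toℕ k        ∎)
    where
    open ≡-Reasoning
    shifted : (toℕ j + s) % l ≡ (toℕ k + s) % l
    shifted = trans (sym (toℕ-mod (toℕ j + s))) (trans (cong toℕ e) (toℕ-mod (toℕ k + s)))

  Succ-rotate : ∀ s j k → Succ (toℕ j) (toℕ k) ⇔ Succ (toℕ (rotate s j)) (toℕ (rotate s k))
  Succ-rotate s j k = mk⇔
    (λ e → subst₂ Succ (sym (toℕ-mod (toℕ j + s))) (sym (toℕ-mod (toℕ k + s)))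
             (to (Succ-% (toℕ j + s) (toℕ k + s)) (to (Succ-+ s (toℕ j) (toℕ k)) e)))
    (λ e → from (Succ-+ s (toℕ j) (toℕ k)) (from (Succ-% (toℕ j + s) (toℕ k + s))
             (subst₂ Succ (toℕ-mod (toℕ j + s)) (toℕ-mod (toℕ k + s)) e)))

  CycAdj-rotate : ∀ s {j k} → CycAdj l j k ⇔ CycAdj l (rotate s j) (rotate s k)
  CycAdj-rotate s {j} {k} = mk⇔
    (from (CycAdj⇔Succ {rotate s j} {rotate s k}) ∘ Sum.map (to (Succ-rotate s j k)) (to (Succ-rotate s k j))
      ∘ to (CycAdj⇔Succ {j} {k}))
    (from (CycAdj⇔Succ {j} {k}) ∘ Sum.map (from (Succ-rotate s j k)) (from (Succ-rotate s k j))
      ∘ to (CycAdj⇔Succ {rotate s j} {rotate s k}))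

  IsHole-rotate : ∀ {n} {G : Graph n} {H : Fin l → Fin n} → IsHole G l H → ∀ s → IsHole G l (H ∘ rotate s)
  IsHole-rotate {G = G} {H} (4≤l , H-injective , H-adjacent) s =
    4≤l , rotate-injective s ∘ H-injective , adjacent
    where
    adjacent : ∀ j k → j ≢ k →
      (G (H (rotate s j)) (H (rotate s k)) → CycAdj l j k) × (CycAdj l j k → G (H (rotate s j)) (H (rotate s k)))
    adjacent j k j≢k =
      let (forth , back) = H-adjacent (rotate s j) (rotate s k) (j≢k ∘ rotate-injective s)
      in from (CycAdj-rotate s {j} {k}) ∘ forth , back ∘ to (CycAdj-rotate s {j} {k})

minimizer : ∀ {m} (f : Fin (suc m) → ℕ) → Σ (Fin (suc m)) λ k₀ → ∀ k → f k₀ ≤ f k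
minimizer f = argmin f Fin.zero (allFinL _) , λ k → All.lookup (f[argmin]≤f[xs] {f = f} Fin.zero (allFinL _)) (∈-allFin k)

module _ {n} {G : Graph n} (rank : Fin n → ℕ)
  (eliminable : ∀ {x u v} → G x u → G x v → u ≢ v → rank x ≤ rank u → rank x ≤ rank v → G u v) where

  hole-without-least-rank : ∀ {m} {W : Fin m → Fin n} → IsHole G m W →
    ∀ k₀ → ¬ (∀ k → rank (W k₀) ≤ rank (W k))
  hole-without-least-rank {suc (suc (suc (suc m)))} {W} hole k₀ minimal =
    contradiction (adjacent one last one≢last G₁ₗ) ¬adj
    where
    M : ℕ
    M = suc (suc (suc m))
    W′ : Fin (suc M) → Fin n
    W′ = W ∘ Cyclic.rotate M (toℕ k₀)
    hole′ : IsHole G (suc M) W′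
    hole′ = Cyclic.IsHole-rotate M {G = G} hole (toℕ k₀)
    W′0≡Wk₀ : W′ Fin.zero ≡ W k₀
    W′0≡Wk₀ = cong W (toℕ-injective (trans (Cyclic.toℕ-mod M (toℕ k₀)) (m<n⇒m%n≡m (toℕ<n k₀))))

    one last : Fin (suc M)
    one  = Fin.suc Fin.zero
    last = fromℕ M

    one≢last : one ≢ last
    one≢last e = contradiction (trans (cong toℕ e) (toℕ-fromℕ M)) λ ()

    ¬adj : ¬ CycAdj (suc M) one last
    ¬adj rewrite toℕ-fromℕ M =
      λ { (inj₁ ()) ; (inj₂ (inj₁ ())) ; (inj₂ (inj₂ (inj₁ (() , _)))) ; (inj₂ (inj₂ (inj₂ (_ , ())))) }

    adjacent : ∀ j k → j ≢ k → G (W′ j) (W′ k) → CycAdj (suc M) j k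
    adjacent j k j≢k = proj₁ (proj₂ (proj₂ hole′) j k j≢k)

    adjacent⁻ : ∀ j k → j ≢ k → CycAdj (suc M) j k → G (W′ j) (W′ k)
    adjacent⁻ j k j≢k = proj₂ (proj₂ (proj₂ hole′) j k j≢k)

    rank-W′0 : ∀ k → rank (W′ Fin.zero) ≤ rank (W′ k)
    rank-W′0 k = subst (λ v → rank v ≤ rank (W′ k)) (sym W′0≡Wk₀) (minimal (Cyclic.rotate M (toℕ k₀) k))

    G₁ₗ : G (W′ one) (W′ last)
    G₁ₗ = eliminable (adjacent⁻ Fin.zero one (λ ()) (inj₁ refl))
                     (adjacent⁻ Fin.zero last (λ ()) (inj₂ (inj₂ (inj₂ (cong suc (toℕ-fromℕ M) , refl)))))
                     (one≢last ∘ proj₁ (proj₂ hole′)) (rank-W′0 one) (rank-W′0 last)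
  hole-without-least-rank {zero}                      (() , _)
  hole-without-least-rank {suc zero}                  (s≤s () , _)
  hole-without-least-rank {suc (suc zero)}            (s≤s (s≤s ()) , _)
  hole-without-least-rank {suc (suc (suc zero))}      (s≤s (s≤s (s≤s ())) , _)

  no-hole : ∀ {m} (W : Fin m → Fin n) → ¬ IsHole G m W
  no-hole {zero}  W (() , _)
  no-hole {suc m} W hole = hole-without-least-rank hole (proj₁ (minimizer (rank ∘ W))) (proj₂ (minimizer (rank ∘ W)))

-- Phylogeny graphs and the orientation of a hole of U(D)

module _ {n} (D : Digraph n) where

  Arc? : ∀ u v → Dec (Arc D u v)
  Arc? u v = T? (D u v)

  P-sym : ∀ {u v} → P D u v → P D v u
  P-sym (u≢v , inj₁ uv)                = u≢v ∘ sym , inj₂ (inj₁ uv)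
  P-sym (u≢v , inj₂ (inj₁ vu))         = u≢v ∘ sym , inj₁ vu
  P-sym (u≢v , inj₂ (inj₂ (w , uw , vw))) = u≢v ∘ sym , inj₂ (inj₂ (w , vw , uw))

  P-irrefl : ∀ {u} → ¬ P D u u
  P-irrefl (u≢u , _) = u≢u refl

  U⇒P : ∀ {u v} → u ≢ v → U D u v → P D u v
  U⇒P u≢v (inj₁ uv) = u≢v , inj₁ uv
  U⇒P u≢v (inj₂ vu) = u≢v , inj₂ (inj₁ vu)

  P-at-terminal : ∀ {x u} → (∀ y → ¬ Arc D x y) → P D x u → Arc D u x
  P-at-terminal terminal (_ , inj₁ xu)                 = contradiction xu (terminal _)
  P-at-terminal terminal (_ , inj₂ (inj₁ ux))          = ux
  P-at-terminal terminal (_ , inj₂ (inj₂ (w , xw , _))) = contradiction xw (terminal w)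

  P? : ∀ u v → Dec (P D u v)
  P? u v with u Fin.≟ v
  ... | yes refl = no P-irrefl
  ... | no u≢v with Arc? u v ⊎-dec (Arc? v u ⊎-dec any? (λ w → Arc? u w ×-dec Arc? v w))
  ...   | yes adj = yes (u≢v , adj)
  ...   | no ¬adj = no (¬adj ∘ proj₂)

  ¬three-out : ∀ {u v₁ v₂ v₃} → outdeg D u ≤ 2 → v₁ ≢ v₂ → v₁ ≢ v₃ → v₂ ≢ v₃ →
    Arc D u v₁ → Arc D u v₂ → ¬ Arc D u v₃
  ¬three-out {u} outdeg≤2 v₁≢v₂ v₁≢v₃ v₂≢v₃ a₁ a₂ a₃ = <⇒≱ (s≤s (s≤s (s≤s z≤n))) (≤-trans three≤outdeg outdeg≤2)
    where
    three≤outdeg : 3 ≤ outdeg D u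
    three≤outdeg = length≤countB (D u) ((v₁≢v₂ ∷ v₁≢v₃ ∷ []) ∷ (v₂≢v₃ ∷ []) ∷ [] ∷ []) (a₁ ∷ a₂ ∷ a₃ ∷ [])

  2≤indeg : ∀ {u₁ u₂ v} → u₁ ≢ u₂ → Arc D u₁ v → Arc D u₂ v → 2 ≤ indeg D v
  2≤indeg {v = v} u₁≢u₂ a₁ a₂ =
    length≤countB (λ u → D u v) ((u₁≢u₂ ∷ []) ∷ [] ∷ []) (a₁ ∷ a₂ ∷ [])

module _ {n} {D : Digraph n} (acyclic : Acyclic D) where

  Arc-irrefl : ∀ {u} → ¬ Arc D u u
  Arc-irrefl {u} uu = acyclic u [ uu ]

  Arc-asym : ∀ {u v} → Arc D u v → ¬ Arc D v u
  Arc-asym {u} uv vu = acyclic u (uv ∷ [ vu ])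

  U-irrefl : ∀ {u} → ¬ U D u u
  U-irrefl (inj₁ uu) = Arc-irrefl uu
  U-irrefl (inj₂ uu) = Arc-irrefl uu

module HoleSequence {n} {D : Digraph n} (acyclic : Acyclic D)
  {L} {H : Fin (suc L) → Fin n} (hole : IsHole (U D) (suc L) H) where

  open Cyclic L

  private
    l : ℕ
    l = suc L
    H-injective : ∀ {j k} → H j ≡ H k → j ≡ k
    H-injective = proj₁ (proj₂ hole)
    H-adjacent : ∀ j k → j ≢ k → (U D (H j) (H k) → CycAdj l j k) × (CycAdj l j k → U D (H j) (H k))
    H-adjacent = proj₂ (proj₂ hole)
    2≤L : 2 ≤ L
    2≤L = ≤-pred (≤-trans (s≤s (s≤s (s≤s z≤n))) (proj₁ hole))

  v : ℕ → Fin n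
  v x = H (x mod l)

  v-cong : ∀ x y → x % l ≡ y % l → v x ≡ v y
  v-cong x y e = cong H (toℕ-injective (trans (toℕ-mod x) (trans e (sym (toℕ-mod y)))))

  v-injective-mod : ∀ x y → v x ≡ v y → x % l ≡ y % l
  v-injective-mod x y e = trans (sym (toℕ-mod x)) (trans (cong toℕ (H-injective e)) (toℕ-mod y))

  v-injective : ∀ {x y} → x < l → y < l → v x ≡ v y → x ≡ y
  v-injective {x} {y} x<l y<l e =
    trans (sym (m<n⇒m%n≡m x<l)) (trans (v-injective-mod x y e) (m<n⇒m%n≡m y<l))

  v-periodic : ∀ x → v (x + l) ≡ v x
  v-periodic x = v-cong (x + l) x ([m+n]%n≡m%n x l)

  v-adjacent : ∀ {x y} → x < l → y < l → U D (v x) (v y) →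
    (suc x ≡ y ⊎ (suc x ≡ l × y ≡ 0)) ⊎ (suc y ≡ x ⊎ (suc y ≡ l × x ≡ 0))
  v-adjacent {x} {y} x<l y<l adj =
    Sum.map (Succ⇒ x<l y<l ∘ from (Succ-% x y) ∘ subst₂ Succ (toℕ-mod x) (toℕ-mod y))
            (Succ⇒ y<l x<l ∘ from (Succ-% y x) ∘ subst₂ Succ (toℕ-mod y) (toℕ-mod x))
            (to CycAdj⇔Succ (proj₁ (H-adjacent (x mod l) (y mod l) distinct) adj))
    where
    distinct : x mod l ≢ y mod l
    distinct e = U-irrefl acyclic (subst (U D (v x)) (sym (cong H e)) adj)

  v-edge : ∀ x → U D (v x) (v (suc x))
  v-edge x = proj₂ (H-adjacent (x mod l) (suc x mod l) distinct) (from CycAdj⇔Succ (inj₁ succ))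
    where
    succ : Succ (toℕ (x mod l)) (toℕ (suc x mod l))
    succ = subst₂ Succ (sym (toℕ-mod x)) (sym (toℕ-mod (suc x))) (to (Succ-% x (suc x)) refl)
    distinct : x mod l ≢ suc x mod l
    distinct e = ¬Succ-refl 2≤L x (sym (trans (sym (toℕ-mod x)) (trans (cong toℕ e) (toℕ-mod (suc x)))))

  v-distinct₂ : ∀ x → v x ≢ v (suc (suc x))
  v-distinct₂ x e =
    contradiction (trans (sym (m<n⇒m%n≡m 2<l)) (sym (%-cancelʳ-+ x 0 2 (v-injective-mod x (suc (suc x)) e)))) λ ()
    where
    2<l : 2 < l
    2<l = s≤s 2≤L

  Forward : ℕ → Set
  Forward x = Arc D (v x) (v (suc x))

  Forward? : ∀ x → Dec (Forward x)
  Forward? x = Arc? D (v x) (v (suc x))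

  Forward-periodic : ∀ x → Forward (x + l) ≡ Forward x
  Forward-periodic x = cong₂ (Arc D) (v-periodic x) (v-periodic (suc x))

  private
    ¬all-forward : ¬ (∀ {x} → x < l → Forward x)
    ¬all-forward forward = acyclic (v 0) (subst (TransClosure (Arc D) (v 0)) (v-periodic 0) (path L ≤-refl))
      where
      path : ∀ k → k ≤ L → TransClosure (Arc D) (v 0) (v (suc k))
      path zero    _     = [ forward (s≤s z≤n) ]
      path (suc k) 1+k≤L = path k (≤-trans (n≤1+n k) 1+k≤L) ∷ʳ forward (s≤s 1+k≤L)

    ¬all-backward : ¬ (∀ {x} → x < l → ¬ Forward x)
    ¬all-backward backward = acyclic (v 0) (subst (λ u → TransClosure (Arc D) u (v 0)) (v-periodic 0) (path L ≤-refl))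
      where
      back : ∀ {x} → x < l → Arc D (v (suc x)) (v x)
      back {x} x<l with v-edge x
      ... | inj₁ fwd = contradiction fwd (backward x<l)
      ... | inj₂ bwd = bwd
      path : ∀ k → k ≤ L → TransClosure (Arc D) (v (suc k)) (v 0)
      path zero    _     = [ back (s≤s z≤n) ]
      path (suc k) 1+k≤L = back (s≤s 1+k≤L) ∷ path k (≤-trans (n≤1+n k) 1+k≤L)

    some-backward : ∃ λ k → k < l × ¬ Forward k
    some-backward with anyUpTo? (¬? ∘ Forward?) l
    ... | yes found = found
    ... | no none = contradiction (λ {x} x<l → decidable-stable (Forward? x) (λ ¬f → none (x , x<l , ¬f))) ¬all-forward

    some-forward : ∃ λ m → m < l × Forward m
    some-forward with anyUpTo? Forward? l
    ... | yes found = found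
    ... | no none = contradiction (λ {x} x<l f → none (x , x<l , f)) ¬all-backward

  source-exists : ∃ λ r → Arc D (v (suc r)) (v r) × Arc D (v (suc r)) (v (suc (suc r)))
  source-exists with some-backward | some-forward
  ... | k , k<l , ¬fk | m , _ , fm
    with rise Forward? (≤-trans (<⇒≤ k<l) (m≤n+m l m)) ¬fk (subst id (sym (Forward-periodic m)) fm)
  ...   | r , ¬fr , f1+r with v-edge r
  ...     | inj₁ fr = contradiction fr ¬fr
  ...     | inj₂ br = r , br , f1+r

  sink-exists : ∃ λ r → Arc D (v r) (v (suc r)) × Arc D (v (suc (suc r))) (v (suc r))
  sink-exists with some-backward | some-forward
  ... | k , _ , ¬fk | m , m<l , fm
    with fall Forward? (≤-trans (<⇒≤ m<l) (m≤n+m l k)) fm (¬fk ∘ subst id (Forward-periodic k))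
  ...   | r , fr , ¬f1+r with v-edge (suc r)
  ...     | inj₁ f1+r = contradiction f1+r ¬f1+r
  ...     | inj₂ b1+r = r , fr , b1+r

-- A hole of U(D) whose vertex 0 is a source

module SourcedHole {n} {D : Digraph n} {i} (ijD : IsIJDigraph i 2 D) (2≤i : 2 ≤ i)
  {L} {W : Fin (suc L) → Fin n} (hole : IsHole (U D) (suc L) W) (long : 3 * i + 1 ≤ suc L)
  (src-next : Arc D (W (0 mod suc L)) (W (1 mod suc L)))
  (src-prev : Arc D (W (0 mod suc L)) (W (L mod suc L))) where

  private
    V : Set
    V = Fin n
    l : ℕ
    l = suc L
    acyclic : Acyclic D
    acyclic = proj₁ ijD
    indeg≤i : ∀ v → indeg D v ≤ i
    indeg≤i = proj₁ (proj₂ ijD)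
    outdeg≤2 : ∀ v → outdeg D v ≤ 2
    outdeg≤2 = proj₂ (proj₂ ijD)

  open HoleSequence acyclic hole renaming (v to h)
    using (v-periodic; v-edge; v-adjacent; v-injective; v-distinct₂)

  6≤L : 6 ≤ L
  6≤L = ≤-pred (≤-trans (s≤s (*-monoʳ-≤ 3 2≤i)) (subst (_≤ l) (+-comm (3 * i) 1) long))

  _⇒_ : ℕ → ℕ → Set
  p ⇒ q = Arc D (h p) (h q)

  h-injective : ∀ {p q} → p ≤ L → q ≤ L → h p ≡ h q → p ≡ q
  h-injective p≤L q≤L = v-injective (s≤s p≤L) (s≤s q≤L)

  h-distinct₁ : ∀ p → h p ≢ h (suc p)
  h-distinct₁ p e = U-irrefl acyclic (subst (U D (h p)) (sym e) (v-edge p))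

  h-wrap : h l ≡ h 0
  h-wrap = v-periodic 0

  inner-adjacent : ∀ {p q} → 1 ≤ p → 1 ≤ q → p ≤ L → q ≤ L → U D (h p) (h q) → suc p ≡ q ⊎ suc q ≡ p
  inner-adjacent 1≤p 1≤q p≤L q≤L adj with v-adjacent (s≤s p≤L) (s≤s q≤L) adj
  ... | inj₁ (inj₁ e)         = inj₁ e
  ... | inj₁ (inj₂ (_ , refl)) = contradiction 1≤q λ ()
  ... | inj₂ (inj₁ e)         = inj₂ e
  ... | inj₂ (inj₂ (_ , refl)) = contradiction 1≤p λ ()

  apex-adjacent : ∀ {q} → q ≤ L → U D (h 0) (h q) → q ≡ 1 ⊎ q ≡ L
  apex-adjacent q≤L adj with v-adjacent (s≤s z≤n) (s≤s q≤L) adj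
  ... | inj₁ (inj₁ e)          = inj₁ (sym e)
  ... | inj₁ (inj₂ (1≡l , _))  = contradiction 6≤L (subst (λ x → ¬ 6 ≤ x) (suc-injective 1≡l) λ ())
  ... | inj₂ (inj₁ ())
  ... | inj₂ (inj₂ (1+q≡l , _)) = inj₂ (suc-injective 1+q≡l)

  apex-out : ∀ {w} → Arc D (h 0) w → w ≡ h 1 ⊎ w ≡ h L
  apex-out {w} 0w with w Fin.≟ h 1 | w Fin.≟ h L
  ... | yes e | _     = inj₁ e
  ... | no _  | yes e = inj₂ e
  ... | no w≢1 | no w≢L = contradiction 0w
    (¬three-out D (outdeg≤2 (h 0)) h1≢hL (w≢1 ∘ sym) (w≢L ∘ sym) src-next src-prev)
    where
    h1≢hL : h 1 ≢ h L
    h1≢hL e = contradiction (h-injective (≤-trans (s≤s z≤n) 6≤L) ≤-refl e)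
      λ { refl → contradiction 6≤L λ { (s≤s ()) } }

  Sink : ℕ → Set
  Sink p = pred p ⇒ p × suc p ⇒ p

  Sink? : ∀ p → Dec (Sink p)
  Sink? p = Arc? D (h (pred p)) (h p) ×-dec Arc? D (h (suc p)) (h p)

  Sink⇒¬Sink-suc : ∀ {p} → Sink p → ¬ Sink (suc p)
  Sink⇒¬Sink-suc (_ , p+1⇒p) (p⇒p+1 , _) = Arc-asym acyclic p⇒p+1 p+1⇒p

  ¬Sink-out : ∀ {p} → 1 ≤ p → ¬ Sink p → p ⇒ pred p ⊎ p ⇒ suc p
  ¬Sink-out {suc p} _ ¬sink with v-edge p | v-edge (suc p)
  ... | inj₂ back | _         = inj₁ back
  ... | inj₁ _    | inj₁ fwd  = inj₂ fwd
  ... | inj₁ in₁  | inj₂ in₂  = contradiction (in₁ , in₂) ¬sink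

  OffHole : V → Set
  OffHole w = ∀ k → W k ≢ w

  on-or-off : ∀ w → (∃ λ t → t ≤ L × h t ≡ w) ⊎ OffHole w
  on-or-off w with any? (λ k → W k Fin.≟ w)
  ... | yes (k , Wk≡w) = inj₁ (toℕ k , ≤-pred (toℕ<n k) , trans (cong W k-mod) Wk≡w)
    where
    k-mod : toℕ k mod l ≡ k
    k-mod = toℕ-injective (trans (Cyclic.toℕ-mod L (toℕ k)) (m<n⇒m%n≡m (toℕ<n k)))
  ... | no ¬on = inj₂ λ k Wk≡w → ¬on (k , Wk≡w)

  -- a non-sink position has one out-neighbour on the hole, so at most one off it
  off-out-unique : ∀ {p w w′} → 1 ≤ p → ¬ Sink p → OffHole w → OffHole w′ →
    Arc D (h p) w → Arc D (h p) w′ → w ≡ w′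
  off-out-unique {p} {w} {w′} 1≤p ¬sink off off′ pw pw′ with w Fin.≟ w′
  ... | yes e = e
  ... | no w≢w′ with ¬Sink-out 1≤p ¬sink
  ...   | inj₁ back = contradiction pw′ (¬three-out D (outdeg≤2 (h p)) (off _) (off′ _) w≢w′ back pw)
  ...   | inj₂ fwd  = contradiction pw′ (¬three-out D (outdeg≤2 (h p)) (off _) (off′ _) w≢w′ fwd pw)

  off-out⇒¬both : ∀ {p w} → 1 ≤ p → OffHole w → Arc D (h p) w → p ⇒ pred p → ¬ p ⇒ suc p
  off-out⇒¬both {suc p} {w} _ off pw back =
    ¬three-out D (outdeg≤2 (h (suc p))) (off _) (v-distinct₂ p) (off _ ∘ sym) back pw

  CommonOffOut : ℕ → ℕ → Set
  CommonOffOut p q = ∃ λ w → Arc D (h p) w × Arc D (h q) w × OffHole w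

  P-far : ∀ {p q} → 1 ≤ p → suc (suc p) ≤ q → q ≤ L → P D (h p) (h q) →
    (q ≡ suc (suc p) × Sink (suc p)) ⊎ CommonOffOut p q
  P-far {p} {q} 1≤p p+2≤q q≤L (_ , adj) = far adj
    where
    p<q : p < q
    p<q = ≤-trans (n≤1+n _) p+2≤q
    1≤q : 1 ≤ q
    1≤q = ≤-trans 1≤p (<⇒≤ p<q)
    p≤L : p ≤ L
    p≤L = ≤-trans (<⇒≤ p<q) q≤L

    not-adjacent : ¬ (suc p ≡ q ⊎ suc q ≡ p)
    not-adjacent (inj₁ refl) = <⇒≱ (s≤s (n<1+n p)) p+2≤q
    not-adjacent (inj₂ refl) = <⇒≱ (s≤s (≤-trans (n≤1+n _) (n≤1+n _))) p+2≤q

    through-hole : ∀ {t} → suc p ≡ t ⊎ suc t ≡ p → suc q ≡ t ⊎ suc t ≡ q → suc p ≡ t × suc t ≡ q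
    through-hole (inj₁ refl) (inj₂ refl) = refl , refl
    through-hole (inj₁ refl) (inj₁ e)    = contradiction (sym (suc-injective e)) (<⇒≢ p<q)
    through-hole (inj₂ refl) (inj₁ e)    = contradiction (≤-trans (≤-reflexive e) (n≤1+n _)) (<⇒≯ p<q)
    through-hole (inj₂ refl) (inj₂ e)    = contradiction e (<⇒≢ p<q)

    common : ∀ {w} → Arc D (h p) w → Arc D (h q) w → (∃ λ t → t ≤ L × h t ≡ w) ⊎ OffHole w →
      (q ≡ suc (suc p) × Sink (suc p)) ⊎ CommonOffOut p q
    common pw qw (inj₂ off) = inj₂ (_ , pw , qw , off)
    common pw qw (inj₁ (zero , _ , refl)) with apex-adjacent p≤L (inj₂ pw)
    ... | inj₁ refl = contradiction pw (Arc-asym acyclic src-next)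
    ... | inj₂ refl = contradiction q≤L (<⇒≱ p<q)
    common pw qw (inj₁ (suc t , t≤L , refl)) with
      through-hole (inner-adjacent 1≤p (s≤s z≤n) p≤L t≤L (inj₁ pw))
                   (inner-adjacent 1≤q (s≤s z≤n) q≤L t≤L (inj₁ qw))
    ... | refl , refl = inj₁ (refl , pw , qw)

    far : Arc D (h p) (h q) ⊎ Arc D (h q) (h p) ⊎ ∃ (λ w → Arc D (h p) w × Arc D (h q) w) →
      (q ≡ suc (suc p) × Sink (suc p)) ⊎ CommonOffOut p q
    far (inj₁ pq)                = contradiction (inner-adjacent 1≤p 1≤q p≤L q≤L (inj₁ pq)) not-adjacent
    far (inj₂ (inj₁ qp))         = contradiction (inner-adjacent 1≤p 1≤q p≤L q≤L (inj₂ qp)) not-adjacent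
    far (inj₂ (inj₂ (w , pw , qw))) = common pw qw (on-or-off w)

  next : ℕ → ℕ
  next p with Sink? (suc p)
  ... | yes _ = suc (suc p)
  ... | no _  = suc p

  next-spec : ∀ p → (¬ Sink (suc p) × next p ≡ suc p) ⊎ (Sink (suc p) × next p ≡ suc (suc p))
  next-spec p with Sink? (suc p)
  ... | yes sink = inj₂ (sink , refl)
  ... | no ¬sink = inj₁ (¬sink , refl)

  <-next : ∀ p → p < next p
  <-next p with next-spec p
  ... | inj₁ (_ , e) = ≤-reflexive (sym e)
  ... | inj₂ (_ , e) = ≤-trans (n≤1+n _) (≤-reflexive (sym e))

  next-¬Sink : ∀ p → ¬ Sink (next p)
  next-¬Sink p with next-spec p
  ... | inj₁ (¬sink , e) = subst (¬_ ∘ Sink) (sym e) ¬sink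
  ... | inj₂ (sink , e)  = subst (¬_ ∘ Sink) (sym e) (Sink⇒¬Sink-suc sink)

  next-≤ : ∀ {p e} → p < e → ¬ Sink e → next p ≤ e
  next-≤ {p} p<e ¬sink with next-spec p | m≤n⇒m<n∨m≡n p<e
  ... | inj₁ (_ , e) | _              = ≤-trans (≤-reflexive e) p<e
  ... | inj₂ (_ , e) | inj₁ p+1<e     = ≤-trans (≤-reflexive e) p+1<e
  ... | inj₂ (sink , _) | inj₂ refl   = contradiction sink ¬sink

  P-next : ∀ p → P D (h p) (h (next p))
  P-next p with next-spec p
  ... | inj₁ (_ , e) rewrite e = U⇒P D (h-distinct₁ p) (v-edge p)
  ... | inj₂ (sink , e) rewrite e = v-distinct₂ p , inj₂ (inj₂ (h (suc p) , sink))

  NonSinkWalk : ℕ → ℕ → Set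
  NonSinkWalk p e =
    Σ (List V) λ zs → Walk (P D) (h p) zs (h e) × (∀ {z} → z ∈ zs → ∃ λ t → p < t × t ≤ e × ¬ Sink t × z ≡ h t)

  walk : ∀ {p e} → p ≤ e → ¬ Sink e → NonSinkWalk p e
  walk {p} {e} p≤e ¬sink = go (<-wellFounded (e ∸ p)) p≤e
    where
    go : ∀ {p} → Acc _<_ (e ∸ p) → p ≤ e → NonSinkWalk p e
    go {p} (acc rec) p≤e with m≤n⇒m<n∨m≡n p≤e
    ... | inj₂ refl = [] , refl , λ ()
    ... | inj₁ p<e =
      let (zs , steps , on) = go (rec (∸-monoʳ-< (<-next p) (next-≤ p<e ¬sink))) (next-≤ p<e ¬sink)
      in h (next p) ∷ zs , (P-next p , steps) , λ
        { (here refl) → next p , <-next p , next-≤ p<e ¬sink , next-¬Sink p , refl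
        ; (there z∈) → let (t , next<t , t≤e , ¬sinkt , z≡) = on z∈
                       in t , <-trans (<-next p) next<t , t≤e , ¬sinkt , z≡ }

  hole-at : ∀ {q e} → next q < e → e ≤ L → ¬ Sink e → P D (h q) (h e) → ¬ P D (h (next q)) (h e) →
    (∀ z → next q < z → z < e → ¬ Sink z → ¬ P D (h q) (h z)) → InducedContainsHole (P D) W
  hole-at {q} {e} g<e e≤L ¬sink qe ¬ge inner with walk (<⇒≤ g<e) ¬sink
  ... | zs , steps , on with hole-from-apex (P? D) (P-sym D) (P-irrefl D) zs steps (P-next q) qe g≢e ¬ge q∉zs far
    where
    q<e : q < e
    q<e = <-trans (<-next q) g<e
    g≢e : h (next q) ≢ h e
    g≢e = <⇒≢ g<e ∘ h-injective (≤-trans (<⇒≤ g<e) e≤L) e≤L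
    q∉zs : h q ∉ zs
    q∉zs q∈ with on q∈
    ... | t , g<t , t≤e , _ , hq≡ht =
      <⇒≢ (<-trans (<-next q) g<t) (h-injective (≤-trans (<⇒≤ q<e) e≤L) (≤-trans t≤e e≤L) hq≡ht)
    far : ∀ {z} → z ∈ zs → z ≢ h e → ¬ P D (h q) z
    far z∈ z≢e with on z∈
    ... | t , g<t , t≤e , ¬sinkt , refl = inner t g<t (≤∧≢⇒< t≤e λ { refl → z≢e refl }) ¬sinkt
  ...   | m , W′ , hole′ , W′∈ = m , W′ , hole′ , λ k → position (W′∈ k)
    where
    position : ∀ {x} → x ∈ h q ∷ h (next q) ∷ zs → Σ (Fin l) λ j → W j ≡ x
    position (here refl)         = q mod l , refl
    position (there (here refl)) = next q mod l , refl
    position (there (there z∈)) with on z∈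
    ... | t , _ , _ , _ , refl = t mod l , refl

  next-Sink : ∀ {p} → Sink (suc p) → next p ≡ suc (suc p)
  next-Sink {p} sink with next-spec p
  ... | inj₁ (¬sink , _) = contradiction sink ¬sink
  ... | inj₂ (_ , e)     = e

  first : ℕ
  first = next 0

  first≤2 : first ≤ 2
  first≤2 with next-spec 0
  ... | inj₁ (_ , e) = ≤-trans (≤-reflexive e) (n≤1+n 1)
  ... | inj₂ (_ , e) = ≤-reflexive e

  1+predL≡L : suc (pred L) ≡ L
  1+predL≡L = suc-pred L {{>-nonZero (≤-trans (s≤s z≤n) 6≤L)}}

  last : ℕ
  last with Sink? L
  ... | yes _ = pred L
  ... | no _  = L

  last-spec : (¬ Sink L × last ≡ L) ⊎ (Sink L × last ≡ pred L)
  last-spec with Sink? L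
  ... | yes sink = inj₂ (sink , refl)
  ... | no ¬sink = inj₁ (¬sink , refl)

  last≤L : last ≤ L
  last≤L with last-spec
  ... | inj₁ (_ , e) = ≤-reflexive e
  ... | inj₂ (_ , e) = ≤-trans (≤-reflexive e) pred[n]≤n

  last-¬Sink : ¬ Sink last
  last-¬Sink with last-spec
  ... | inj₁ (¬sink , e) = subst (¬_ ∘ Sink) (sym e) ¬sink
  ... | inj₂ (sink , e)  = subst (¬_ ∘ Sink) (sym e) λ sink′ →
    Sink⇒¬Sink-suc sink′ (subst Sink (sym 1+predL≡L) sink)

  first+3≤last : 3 + first ≤ last
  first+3≤last with last-spec
  ... | inj₁ (_ , e) = ≤-trans (s≤s (s≤s (s≤s first≤2))) (≤-trans (n≤1+n 5) (subst (6 ≤_) (sym e) 6≤L))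
  ... | inj₂ (_ , e) = ≤-trans (s≤s (s≤s (s≤s first≤2))) (subst (5 ≤_) (sym e) (pred-mono-≤ 6≤L))

  P-apex-last : P D (h 0) (h last)
  P-apex-last with last-spec
  ... | inj₁ (_ , e) rewrite e = (<⇒≢ (≤-trans (s≤s z≤n) 6≤L) ∘ h-injective z≤n ≤-refl) , inj₁ src-prev
  ... | inj₂ ((prev⇒L , _) , e) rewrite e =
    (<⇒≢ (≤-trans (s≤s z≤n) (pred-mono-≤ 6≤L)) ∘ h-injective z≤n pred[n]≤n)
    , inj₂ (inj₂ (h L , src-prev , prev⇒L))

  apex-far : ∀ {z} → first < z → z < last → ¬ P D (h 0) (h z)
  apex-far {z} first<z z<last (_ , adj) = far adj
    where
    z≤L : z ≤ L
    z≤L = ≤-trans (<⇒≤ z<last) last≤L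
    1≤z : 1 ≤ z
    1≤z = <-≤-trans (s≤s z≤n) (≤-trans (<-next 0) (<⇒≤ first<z))

    not-apex-adjacent : ¬ U D (h 0) (h z)
    not-apex-adjacent u with apex-adjacent z≤L u
    ... | inj₁ refl = <⇒≱ first<z (<-next 0)
    ... | inj₂ refl = <⇒≱ z<last last≤L

    -- a common out-neighbour h 1 makes 1 a sink, and then z = 2 = first
    ¬via-1 : ¬ z ⇒ 1
    ¬via-1 z⇒1 with inner-adjacent 1≤z (s≤s z≤n) z≤L (≤-trans (s≤s z≤n) 6≤L) (inj₁ z⇒1)
    ... | inj₁ e = contradiction (suc-injective e) (<⇒≢ 1≤z ∘ sym)
    ... | inj₂ refl = <-irrefl (next-Sink (src-next , z⇒1)) first<z

    -- a common out-neighbour h L makes L a sink, and then z = pred L = last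
    ¬via-L : ¬ z ⇒ L
    ¬via-L z⇒L with inner-adjacent 1≤z (≤-trans (s≤s z≤n) 6≤L) z≤L ≤-refl (inj₁ z⇒L)
    ... | inj₂ e = 1+n≰n (≤-trans (≤-reflexive e) z≤L)
    ... | inj₁ e with last-spec
    ...   | inj₁ (¬sinkL , _) = ¬sinkL (subst (_⇒ L) (cong pred e) z⇒L , subst (λ u → Arc D u (h L)) (sym h-wrap) src-prev)
    ...   | inj₂ (_ , last≡) = <-irrefl (trans (cong pred e) (sym last≡)) z<last

    far : ¬ (Arc D (h 0) (h z) ⊎ Arc D (h z) (h 0) ⊎ ∃ λ w → Arc D (h 0) w × Arc D (h z) w)
    far (inj₁ 0z)                   = not-apex-adjacent (inj₁ 0z)
    far (inj₂ (inj₁ z0))            = not-apex-adjacent (inj₂ z0)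
    far (inj₂ (inj₂ (w , 0w , zw))) with apex-out 0w
    ... | inj₁ refl = ¬via-1 zw
    ... | inj₂ refl = ¬via-L zw

  -- q is charged with the three positions from block-start q on: q, q + 1 and its out-neighbour on the hole
  block-start : ℕ → ℕ
  block-start q with Arc? D (h q) (h (pred q))
  ... | yes _ = pred q
  ... | no _  = q

  block-start-spec : ∀ q → (q ⇒ pred q × block-start q ≡ pred q) ⊎ (¬ q ⇒ pred q × block-start q ≡ q)
  block-start-spec q with Arc? D (h q) (h (pred q))
  ... | yes back = inj₁ (back , refl)
  ... | no ¬back = inj₂ (¬back , refl)

  block-start-≤ : ∀ q → block-start q ≤ q
  block-start-≤ q with block-start-spec q
  ... | inj₁ (_ , e) = ≤-trans (≤-reflexive e) pred[n]≤n
  ... | inj₂ (_ , e) = ≤-reflexive e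

  pred-≤-block-start : ∀ q → pred q ≤ block-start q
  pred-≤-block-start q with block-start-spec q
  ... | inj₁ (_ , e) = ≤-reflexive (sym e)
  ... | inj₂ (_ , e) = ≤-trans pred[n]≤n (≤-reflexive (sym e))

  1+q≤2+block-start : ∀ q → suc q ≤ 2 + block-start q
  1+q≤2+block-start zero    = s≤s z≤n
  1+q≤2+block-start (suc q) = s≤s (s≤s (pred-≤-block-start (suc q)))

  block-start-next : ∀ p → block-start (next p) ≤ suc p
  block-start-next p with next-spec p
  ... | inj₁ (_ , e) = ≤-trans (block-start-≤ (next p)) (≤-reflexive e)
  ... | inj₂ ((_ , back) , e) with block-start-spec (next p)
  ...   | inj₁ (_ , e′)   = ≤-reflexive (trans e′ (cong pred e))
  ...   | inj₂ (¬back , _) = contradiction (subst (λ x → x ⇒ pred x) (sym e) back) ¬back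

  module _ {w} (off : OffHole w) where

    Q : ℕ → Set
    Q z = 1 ≤ z × z ≤ L × ¬ Sink z × Arc D (h z) w

    Q? : ∀ z → Dec (Q z)
    Q? z = (1 ≤? z) ×-dec ((z ≤? L) ×-dec (¬? (Sink? z) ×-dec Arc? D (h z) w))

    Q-first : Arc D (h first) w → Q first
    Q-first firstw = <-next 0 , ≤-trans first≤2 (≤-trans (s≤s (s≤s z≤n)) 6≤L) , next-¬Sink 0 , firstw

    Q-last : Arc D (h last) w → Q last
    Q-last lastw = ≤-trans (s≤s z≤n) first+3≤last , last≤L , last-¬Sink , lastw

    block-start-fwd : ∀ {q} → Q q → q ⇒ suc q → block-start q ≡ q
    block-start-fwd {q} (1≤q , _ , _ , qw) fwd with block-start-spec q
    ... | inj₁ (back , _) = contradiction fwd (off-out⇒¬both 1≤q off qw back)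
    ... | inj₂ (_ , e)    = e

    block-start-gap : ∀ {q q′} → Q q → q′ ≡ next q ⊎ q′ ≡ next (next q) → block-start q′ ≤ 3 + block-start q
    block-start-gap {q} Qq (inj₁ refl) = ≤-trans (block-start-next q) (≤-trans (1+q≤2+block-start q) (n≤1+n _))
    block-start-gap {q} Qq (inj₂ refl) with next-spec q
    ... | inj₁ (_ , e) = ≤-trans (block-start-next (next q)) (s≤s (≤-trans (≤-reflexive e) (1+q≤2+block-start q)))
    ... | inj₂ ((fwd , _) , e) = begin
      block-start (next (next q))  ≤⟨ block-start-next (next q) ⟩
      suc (next q)                 ≡⟨ cong suc e ⟩
      3 + q                        ≡⟨ cong (3 +_) (block-start-fwd Qq fwd) ⟨
      3 + block-start q            ∎
      where open ≤-Reasoning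

    hole-from-gap : ∀ {q q′} → Q q → Q q′ → q < q′ → (∀ z → q < z → z < q′ → ¬ Q z) →
      ¬ (q′ ≡ next q ⊎ q′ ≡ next (next q)) → InducedContainsHole (P D) W
    hole-from-gap {q} {q′} (1≤q , q≤L , ¬sink , qw) (_ , q′≤L , ¬sink′ , q′w) q<q′ least far =
      hole-at g<q′ q′≤L ¬sink′ qq′ ¬gq′ inner
      where
      g : ℕ
      g = next q
      g<q′ : g < q′
      g<q′ = ≤∧≢⇒< (next-≤ q<q′ ¬sink′) (far ∘ inj₁ ∘ sym)
      g+2≤q′ : suc (suc g) ≤ q′
      g+2≤q′ = ≤-trans (s≤s (<-next g)) (≤∧≢⇒< (next-≤ g<q′ ¬sink′) (far ∘ inj₂ ∘ sym))
      1≤g : 1 ≤ g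
      1≤g = ≤-trans 1≤q (<⇒≤ (<-next q))

      qq′ : P D (h q) (h q′)
      qq′ = <⇒≢ q<q′ ∘ h-injective q≤L q′≤L , inj₂ (inj₂ (w , qw , q′w))

      ¬gq′ : ¬ P D (h g) (h q′)
      ¬gq′ adj with P-far 1≤g g+2≤q′ q′≤L adj
      ... | inj₁ (q′≡g+2 , sink) = far (inj₂ (trans q′≡g+2 (sym (next-Sink sink))))
      ... | inj₂ (w′ , gw′ , q′w′ , off′) = least g (<-next q) g<q′
        (1≤g , ≤-trans (<⇒≤ g<q′) q′≤L , next-¬Sink q ,
         subst (Arc D (h g)) (sym (off-out-unique (≤-trans 1≤g (<⇒≤ g<q′)) ¬sink′ off off′ q′w q′w′)) gw′)

      inner : ∀ z → g < z → z < q′ → ¬ Sink z → ¬ P D (h q) (h z)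
      inner z g<z z<q′ ¬sinkz adj with P-far 1≤q (≤-trans (s≤s (<-next q)) g<z) (≤-trans (<⇒≤ z<q′) q′≤L) adj
      ... | inj₁ (z≡q+2 , sink) = <-irrefl (trans (next-Sink sink) (sym z≡q+2)) g<z
      ... | inj₂ (w″ , qw″ , zw″ , off″) = least z (<-trans (<-next q) g<z) z<q′
        (≤-trans 1≤g (<⇒≤ g<z) , ≤-trans (<⇒≤ z<q′) q′≤L , ¬sinkz ,
         subst (Arc D (h z)) (sym (off-out-unique 1≤q ¬sink off off″ qw qw″)) zw″)

    Cover : ℕ → Set
    Cover q = Σ (List ℕ) λ qs →
      AllPairs _<_ qs × All Q qs × All (q ≤_) qs × 3 + block-start last ≤ block-start q + 3 * length qs

    hole-or-cover : ∀ {q} → Q q → q ≤ last → Q last → InducedContainsHole (P D) W ⊎ Cover q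
    hole-or-cover Qq q≤last Qlast = go (<-wellFounded _) Qq q≤last
      where
      go : ∀ {q} → Acc _<_ (last ∸ q) → Q q → q ≤ last → InducedContainsHole (P D) W ⊎ Cover q
      go {q} (acc rec) Qq q≤last with m≤n⇒m<n∨m≡n q≤last
      ... | inj₂ refl = inj₂ (q ∷ [] , [] ∷ [] , Qq ∷ [] , ≤-refl ∷ [] , ≤-reflexive (+-comm 3 (block-start q)))
      ... | inj₁ q<last with least-above Q? q<last Qlast
      ...   | q′ , q<q′ , q′≤last , Qq′ , least with (q′ ≟ next q) ⊎-dec (q′ ≟ next (next q))
      ...     | no far = inj₁ (hole-from-gap Qq Qq′ q<q′ least far)
      ...     | yes near with go (rec (∸-monoʳ-< q<q′ q′≤last)) Qq′ q′≤last
      ...       | inj₁ hole = inj₁ hole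
      ...       | inj₂ (qs , sorted , allQ , above , bound) =
        inj₂ (q ∷ qs , All.map (<-≤-trans q<q′) above ∷ sorted , Qq ∷ allQ ,
              ≤-refl ∷ All.map (≤-trans (<⇒≤ q<q′)) above ,
              (begin
                3 + block-start last                  ≤⟨ bound ⟩
                block-start q′ + 3 * length qs        ≤⟨ +-monoˡ-≤ (3 * length qs) (block-start-gap Qq near) ⟩
                3 + block-start q + 3 * length qs     ≡⟨ regroup (block-start q) (length qs) ⟨
                block-start q + 3 * suc (length qs)   ∎))
        where
        open ≤-Reasoning
        regroup : ∀ s k → s + 3 * suc k ≡ 3 + s + 3 * k
        regroup s k = trans (cong (s +_) (*-suc 3 k)) (trans (sym (+-assoc s 3 (3 * k))) (cong (_+ 3 * k) (+-comm s 3)))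

    Q-count : ∀ {qs} → AllPairs _<_ qs → All Q qs → length qs ≤ i
    Q-count {qs} sorted allQ = begin
      length qs          ≡⟨ length-map h qs ⟨
      length (map h qs)  ≤⟨ length≤countB (λ u → D u w) (distinct sorted (All.map (proj₁ ∘ proj₂) allQ))
                              (Allₚ.map⁺ (All.map (proj₂ ∘ proj₂ ∘ proj₂) allQ)) ⟩
      indeg D w          ≤⟨ indeg≤i w ⟩
      i                  ∎
      where
      open ≤-Reasoning
      distinct : ∀ {qs} → AllPairs _<_ qs → All (_≤ L) qs → Unique (map h qs)
      distinct []              []              = []
      distinct (q<qs ∷ sorted) (q≤L ∷ bounded) =
        Allₚ.map⁺ (All.zipWith (λ (q<t , t≤L) → <⇒≢ q<t ∘ h-injective q≤L t≤L) (q<qs , bounded))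
        ∷ distinct sorted bounded

    2+L≤3+block-start-last : Q last → 2 + L ≤ 3 + block-start last
    2+L≤3+block-start-last Qlast with last-spec
    ... | inj₁ (_ , e) = begin
      2 + L                    ≡⟨ cong (2 +_) 1+predL≡L ⟨
      3 + pred L               ≡⟨ cong (λ x → 3 + pred x) e ⟨
      3 + pred last            ≤⟨ s≤s (s≤s (s≤s (pred-≤-block-start last))) ⟩
      3 + block-start last     ∎
      where open ≤-Reasoning
    ... | inj₂ ((prev⇒L , _) , e) = begin
      2 + L                    ≡⟨ cong (2 +_) 1+predL≡L ⟨
      3 + pred L               ≡⟨ cong (3 +_) e ⟨
      3 + last                 ≡⟨ cong (3 +_) (block-start-fwd Qlast last⇒1+last) ⟨
      3 + block-start last     ∎
      where
      open ≤-Reasoning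
      last⇒1+last : last ⇒ suc last
      last⇒1+last = subst (λ x → x ⇒ suc x) (sym e) (subst (pred L ⇒_) (sym 1+predL≡L) prev⇒L)

    ¬Cover-first : Q last → ¬ Cover first
    ¬Cover-first Qlast (qs , sorted , allQ , _ , bound) = 1+n≰n (begin
      2 + L                              ≤⟨ 2+L≤3+block-start-last Qlast ⟩
      3 + block-start last               ≤⟨ bound ⟩
      block-start first + 3 * length qs  ≤⟨ +-mono-≤ (block-start-next 0) (*-monoʳ-≤ 3 (Q-count sorted allQ)) ⟩
      1 + 3 * i                          ≡⟨ +-comm 1 (3 * i) ⟩
      3 * i + 1                          ≤⟨ long ⟩
      1 + L                              ∎)
      where open ≤-Reasoning

  contains-hole : InducedContainsHole (P D) W
  contains-hole with P? D (h first) (h last)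
  ... | no ¬adj = hole-at {q = 0} (≤-trans (m≤n+m _ 2) first+3≤last) last≤L last-¬Sink P-apex-last ¬adj
                    (λ _ first<z z<last _ → apex-far first<z z<last)
  ... | yes adj with P-far (<-next 0) (≤-trans (m≤n+m _ 1) first+3≤last) last≤L adj
  ...   | inj₁ (last≡first+2 , _) = contradiction first+3≤last (<-irrefl (sym last≡first+2))
  ...   | inj₂ (w , firstw , lastw , off)
    with hole-or-cover off (Q-first off firstw) (≤-trans (m≤n+m _ 3) first+3≤last) (Q-last off lastw)
  ...     | inj₁ hole  = hole
  ...     | inj₂ cover = contradiction cover (¬Cover-first off (Q-last off lastw))

-- Holes of length at least 3i + 1

InducedContainsHole-∘ : ∀ {n} {G : Graph n} {l m} {H : Fin l → Fin n} (f : Fin m → Fin l) →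
  InducedContainsHole G (H ∘ f) → InducedContainsHole G H
InducedContainsHole-∘ f (k , W , hole , in-H) = k , W , hole , λ j → let (j′ , e) = in-H j in f j′ , e

part1 : (i : ℕ) → 1 ≤ i → (n : ℕ) → (D : Digraph n) → IsIJDigraph i 2 D →
  (l : ℕ) → (H : Fin l → Fin n) → IsHole (U D) l H → 3 * i + 1 ≤ l →
  InducedContainsHole (P D) H
part1 i _ n D ijD@(acyclic , indeg≤i , _) (suc L) H hole long =
  InducedContainsHole-∘ {G = P D} (rotate s)
    (SourcedHole.contains-hole ijD 2≤i (IsHole-rotate {G = U D} hole s) long src-next src-prev)
  where
  open HoleSequence acyclic hole using (v; v-periodic; v-distinct₂; source-exists; sink-exists)
  open Cyclic L using (rotate; rotate-mod; IsHole-rotate)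
  r s : ℕ
  r = proj₁ source-exists
  s = suc r

  rotated : ∀ x → H (rotate s (x mod suc L)) ≡ v (x + s)
  rotated x = cong H (rotate-mod s x)

  src-next : Arc D (H (rotate s (0 mod suc L))) (H (rotate s (1 mod suc L)))
  src-next = subst₂ (Arc D) (sym (rotated 0)) (sym (rotated 1)) (proj₂ (proj₂ source-exists))

  src-prev : Arc D (H (rotate s (0 mod suc L))) (H (rotate s (L mod suc L)))
  src-prev = subst₂ (Arc D) (sym (rotated 0)) (sym (trans (rotated L) (trans (cong v wrap) (v-periodic r))))
    (proj₁ (proj₂ source-exists))
    where
    wrap : L + s ≡ r + suc L
    wrap = trans (+-suc L r) (trans (cong suc (+-comm L r)) (sym (+-suc r L)))

  2≤i : 2 ≤ i
  2≤i = let (t , in₁ , in₂) = sink-exists in ≤-trans (2≤indeg D (v-distinct₂ t) in₁ in₂) (indeg≤i _)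
part1 i _ n D _ zero H (() , _) _

-- A hole of length 3i whose vertices carry no hole of P(D)

data Kind : Set where
  source mid sink : Kind

kind : ℕ → Kind
kind 0 = source
kind 1 = mid
kind 2 = sink
kind (suc (suc (suc p))) = kind p

next-kind : Kind → Kind
next-kind source = mid
next-kind mid    = sink
next-kind sink   = source

kind-suc : ∀ p → kind (suc p) ≡ next-kind (kind p)
kind-suc 0 = refl
kind-suc 1 = refl
kind-suc 2 = refl
kind-suc (suc (suc (suc p))) = kind-suc p

kind-3* : ∀ j → kind (3 * j) ≡ source
kind-3* zero    = refl
kind-3* (suc j) = trans (cong kind (*-suc 3 j)) (kind-3* j)

next-kind≡source : ∀ {k} → next-kind k ≡ source → k ≡ sink
next-kind≡source {sink} _ = refl

third : ℕ → ℕ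
third 0 = 0
third 1 = 0
third 2 = 0
third (suc (suc (suc p))) = suc (third p)

mid-form : ∀ p → kind p ≡ mid → p ≡ 1 + 3 * third p
mid-form 1 _ = refl
mid-form (suc (suc (suc p))) e = trans (cong (3 +_) (mid-form p e)) (cong suc (sym (*-suc 3 (third p))))

module Construction (i : ℕ) (2≤i : 2 ≤ i) where

  N : ℕ
  N = 3 * i

  6≤N : 6 ≤ N
  6≤N = *-monoʳ-≤ 3 2≤i

  1+predN≡N : suc (pred N) ≡ N
  1+predN≡N = suc-pred N {{>-nonZero (≤-trans (s≤s z≤n) 6≤N)}}

  kind-N : kind N ≡ source
  kind-N = kind-3* i

  kind-predN : kind (pred N) ≡ sink
  kind-predN = next-kind≡source (trans (sym (kind-suc (pred N))) (trans (cong kind 1+predN≡N) kind-N))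

  cyc-pred : ℕ → ℕ
  cyc-pred zero    = pred N
  cyc-pred (suc p) = p

  -- position p of the cycle is the vertex suc p; the vertex 0 is the common out-neighbour of all mids
  outs-of : Kind → ℕ → List ℕ
  outs-of source p = suc (suc p) ∷ suc (cyc-pred p) ∷ []
  outs-of mid    p = suc (suc p) ∷ 0 ∷ []
  outs-of sink   p = []

  outs : ℕ → List ℕ
  outs zero    = []
  outs (suc p) = outs-of (kind p) p

  example : Digraph (suc N)
  example u v = ⌊ toℕ v ∈? outs (toℕ u) ⌋

  Step : ℕ → ℕ → Set
  Step x y = y ∈ outs x

  arc⇒step : ∀ u v → Arc example u v → Step (toℕ u) (toℕ v)
  arc⇒step u v = toWitness

  step⇒arc : ∀ u v → Step (toℕ u) (toℕ v) → Arc example u v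
  step⇒arc u v = fromWitness

  kind-cyc-pred : ∀ p → kind p ≡ source → kind (cyc-pred p) ≡ sink
  kind-cyc-pred zero    _ = kind-predN
  kind-cyc-pred (suc p) e = next-kind≡source (trans (sym (kind-suc p)) e)

  level-of : Kind → ℕ
  level-of source = 0
  level-of mid    = 1
  level-of sink   = 2

  level : ℕ → ℕ
  level zero    = 3
  level (suc p) = level-of (kind p)

  step-level : ∀ x {y} → Step x y → level x < level y
  step-level (suc p) s with kind p in e
  step-level (suc p) (here refl)         | source rewrite kind-suc p | e = s≤s z≤n
  step-level (suc p) (there (here refl)) | source rewrite kind-cyc-pred p e = s≤s z≤n
  step-level (suc p) (here refl)         | mid    rewrite kind-suc p | e = s≤s (s≤s z≤n)
  step-level (suc p) (there (here refl)) | mid    = s≤s (s≤s z≤n)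

  acyclic : Acyclic example
  acyclic v cycle = <-irrefl refl (climb cycle)
    where
    climb : ∀ {u w} → TransClosure (Arc example) u w → level (toℕ u) < level (toℕ w)
    climb {u} {w} [ a ]         = step-level (toℕ u) (arc⇒step u w a)
    climb {u} (_∷_ {y = y} a c) = <-trans (step-level (toℕ u) (arc⇒step u y a)) (climb c)

  outdeg≤2 : ∀ u → outdeg example u ≤ 2
  outdeg≤2 u = ≤-trans (countB≤length (example u) (arc⇒step u)) (outs-length (toℕ u))
    where
    outs-length : ∀ x → length (outs x) ≤ 2
    outs-length zero = z≤n
    outs-length (suc p) with kind p
    ... | source = ≤-refl
    ... | mid    = ≤-refl
    ... | sink   = z≤n

  -- the vertex of the position after p on the cycle
  succ-vertex : ℕ → ℕ
  succ-vertex p with suc p ≟ N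
  ... | yes _ = 1
  ... | no _  = suc (suc p)

  succ-vertex-cyc-pred : ∀ p → p < N → succ-vertex (cyc-pred p) ≡ suc p
  succ-vertex-cyc-pred zero _ with suc (pred N) ≟ N
  ... | yes _  = refl
  ... | no ¬e  = contradiction 1+predN≡N ¬e
  succ-vertex-cyc-pred (suc p) p<N with suc p ≟ N
  ... | yes e = contradiction e (<⇒≢ p<N)
  ... | no _  = refl

  ins : ℕ → List ℕ
  ins zero    = applyUpTo (λ j → 2 + 3 * j) i
  ins (suc p) = p ∷ succ-vertex p ∷ []

  step⇒ins : ∀ {x y} → x ≤ N → Step x y → x ∈ ins y
  step⇒ins {suc p} x≤N s with kind p in e
  step⇒ins {suc p} x≤N (here refl)         | source = here refl
  step⇒ins {suc p} x≤N (there (here refl)) | source = there (here (sym (succ-vertex-cyc-pred p x≤N)))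
  step⇒ins {suc p} x≤N (here refl)         | mid    = here refl
  step⇒ins {suc p} x≤N (there (here refl)) | mid    =
    subst (_∈ ins 0) (cong suc (sym (mid-form p e))) (∈-applyUpTo⁺ (λ j → 2 + 3 * j) third<i)
    where
    third<i : third p < i
    third<i = *-cancelˡ-< 3 (third p) i (≤-trans (≤-reflexive (sym (mid-form p e))) (≤-trans (n≤1+n p) x≤N))

  indeg≤i : ∀ v → indeg example v ≤ i
  indeg≤i v = ≤-trans (countB≤length (λ u → example u v) (λ u → step⇒ins (≤-pred (toℕ<n u)) ∘ arc⇒step u v))
                      (ins-length (toℕ v))
    where
    ins-length : ∀ y → length (ins y) ≤ i
    ins-length zero    = ≤-reflexive (length-applyUpTo _ i)
    ins-length (suc _) = 2≤i

  Adjacentℕ : ℕ → ℕ → Set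
  Adjacentℕ p q = suc p ≡ q ⊎ suc q ≡ p ⊎ (suc p ≡ N × q ≡ 0) ⊎ (suc q ≡ N × p ≡ 0)

  step⇒adjacent : ∀ p q → Step (suc p) (suc q) → Adjacentℕ p q
  step⇒adjacent p q s with kind p
  step⇒adjacent p q (here refl)         | source = inj₁ refl
  step⇒adjacent zero q (there (here refl)) | source = inj₂ (inj₂ (inj₂ (1+predN≡N , refl)))
  step⇒adjacent (suc p) q (there (here refl)) | source = inj₂ (inj₁ refl)
  step⇒adjacent p q (here refl)         | mid = inj₁ refl
  step⇒adjacent p q (there (here ()))   | mid

  forward-step : ∀ p → Step (suc p) (suc (suc p)) ⊎ Step (suc (suc p)) (suc p)
  forward-step p with kind p in e
  ... | source = inj₁ (here refl)
  ... | mid    = inj₁ (here refl)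
  ... | sink rewrite kind-suc p | e = inj₂ (there (here refl))

  wrap-step : ∀ p → suc p ≡ N → Step 1 (suc p)
  wrap-step p e = there (here (cong suc (cong pred e)))

  adjacent⇒step : ∀ p q → Adjacentℕ p q → Step (suc p) (suc q) ⊎ Step (suc q) (suc p)
  adjacent⇒step p ._ (inj₁ refl)                 = forward-step p
  adjacent⇒step ._ q (inj₂ (inj₁ refl))          = swap (forward-step q)
  adjacent⇒step p ._ (inj₂ (inj₂ (inj₁ (e , refl)))) = inj₂ (wrap-step p e)
  adjacent⇒step ._ q (inj₂ (inj₂ (inj₂ (e , refl)))) = inj₁ (wrap-step q e)

  hole : IsHole (U example) N Fin.suc
  hole = ≤-trans (s≤s (s≤s (s≤s (s≤s z≤n)))) 6≤N , Finₚ.suc-injective , λ j k _ → forth j k , back j k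
    where
    forth : ∀ j k → U example (Fin.suc j) (Fin.suc k) → CycAdj N j k
    forth j k (inj₁ jk) = step⇒adjacent (toℕ j) (toℕ k) (arc⇒step (Fin.suc j) (Fin.suc k) jk)
    forth j k (inj₂ kj) = CycAdj-sym {j = k} (step⇒adjacent (toℕ k) (toℕ j) (arc⇒step (Fin.suc k) (Fin.suc j) kj))
    back : ∀ j k → CycAdj N j k → U example (Fin.suc j) (Fin.suc k)
    back j k adj with adjacent⇒step (toℕ j) (toℕ k) adj
    ... | inj₁ jk = inj₁ (step⇒arc (Fin.suc j) (Fin.suc k) jk)
    ... | inj₂ kj = inj₂ (step⇒arc (Fin.suc k) (Fin.suc j) kj)

  elim-level-of : Kind → ℕ
  elim-level-of source = 1
  elim-level-of mid    = 2
  elim-level-of sink   = 0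

  elim-rankℕ : ℕ → ℕ
  elim-rankℕ zero    = 0
  elim-rankℕ (suc p) = elim-level-of (kind p)

  elim-rank : Fin (suc N) → ℕ
  elim-rank = elim-rankℕ ∘ toℕ

  elim-rankℕ≤2 : ∀ x → elim-rankℕ x ≤ 2
  elim-rankℕ≤2 zero = z≤n
  elim-rankℕ≤2 (suc p) with kind p
  ... | source = s≤s z≤n
  ... | mid    = ≤-refl
  ... | sink   = z≤n

  terminal : ∀ x → elim-rankℕ x ≡ 0 → ∀ {y} → ¬ Step x y
  terminal zero    _ ()
  terminal (suc p) e s with kind p
  terminal (suc p) () s | source
  terminal (suc p) () s | mid
  terminal (suc p) e () | sink

  hub-step : ∀ x → 2 ≤ elim-rankℕ x → Step x 0
  hub-step (suc p) le with kind p
  hub-step (suc p) (s≤s ()) | source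
  hub-step (suc p) le       | mid = there (here refl)
  hub-step (suc p) ()       | sink

  elim-rank1⇒source : ∀ x → elim-rankℕ x ≡ 1 → ∃ λ p → x ≡ suc p × kind p ≡ source
  elim-rank1⇒source (suc p) e with kind p in k
  elim-rank1⇒source (suc p) e  | source = p , refl , k
  elim-rank1⇒source (suc p) () | mid
  elim-rank1⇒source (suc p) () | sink

  source-out : ∀ p {y} → kind p ≡ source → Step (suc p) y → elim-rankℕ y ≢ 1
  source-out p {y} e s = out (subst (λ k → y ∈ outs-of k p) e s)
    where
    out : y ∈ outs-of source p → elim-rankℕ y ≢ 1
    out (here refl) rewrite kind-suc p | e = λ ()
    out (there (here refl)) rewrite kind-cyc-pred p e = λ ()

  cyc-pred-injective : ∀ {p q} → p < N → q < N → cyc-pred p ≡ cyc-pred q → p ≡ q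
  cyc-pred-injective {zero}  {zero}  _   _   _ = refl
  cyc-pred-injective {zero}  {suc q} _   q<N e = contradiction (trans (sym 1+predN≡N) (cong suc e)) (<⇒≢ q<N ∘ sym)
  cyc-pred-injective {suc p} {zero}  p<N _   e = contradiction (trans (sym 1+predN≡N) (cong suc (sym e))) (<⇒≢ p<N ∘ sym)
  cyc-pred-injective {suc p} {suc q} _   _   e = cong suc e

  shared-out⇒same-source : ∀ {p q c} → kind p ≡ source → kind q ≡ source → p < N → q < N →
    Step (suc p) c → Step (suc q) c → p ≡ q
  shared-out⇒same-source {p} {q} {c} kp kq p<N q<N s t =
    same (subst (λ k → c ∈ outs-of k p) kp s) (subst (λ k → c ∈ outs-of k q) kq t)
    where
    mid≢sink : ∀ {a b} → kind (suc a) ≡ kind b → kind a ≡ source → kind b ≡ sink → ⊥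
    mid≢sink {a} e ka kb = contradiction (trans (sym (trans (kind-suc a) (cong next-kind ka))) (trans e kb)) λ ()
    same : c ∈ outs-of source p → c ∈ outs-of source q → p ≡ q
    same (here refl)         (here e)         = suc-injective (suc-injective e)
    same (here refl) (there (here e)) =
      ⊥-elim (mid≢sink {p} {cyc-pred q} (cong kind (suc-injective e)) kp (kind-cyc-pred q kq))
    same (there (here refl)) (here e) =
      ⊥-elim (mid≢sink {q} {cyc-pred p} (cong kind (sym (suc-injective e))) kq (kind-cyc-pred p kp))
    same (there (here refl)) (there (here e)) = cyc-pred-injective p<N q<N (suc-injective e)

  sources-not-adjacent : ∀ {x u} → elim-rank x ≡ 1 → elim-rank u ≡ 1 → ¬ P example x u
  sources-not-adjacent {x} {u} rx ru (x≢u , adj)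
    with elim-rank1⇒source (toℕ x) rx | elim-rank1⇒source (toℕ u) ru
  ... | p , x≡ , kp | q , u≡ , kq = not-adj adj
    where
    p<N : p < N
    p<N = ≤-trans (≤-reflexive (sym x≡)) (≤-pred (toℕ<n x))
    q<N : q < N
    q<N = ≤-trans (≤-reflexive (sym u≡)) (≤-pred (toℕ<n u))
    from-x : ∀ {w} → Arc example x w → Step (suc p) (toℕ w)
    from-x {w} = subst (λ y → Step y (toℕ w)) x≡ ∘ arc⇒step x w
    from-u : ∀ {w} → Arc example u w → Step (suc q) (toℕ w)
    from-u {w} = subst (λ y → Step y (toℕ w)) u≡ ∘ arc⇒step u w
    not-adj : ¬ (Arc example x u ⊎ Arc example u x ⊎ ∃ λ c → Arc example x c × Arc example u c)
    not-adj (inj₁ xu)                = source-out p kp (from-x xu) ru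
    not-adj (inj₂ (inj₁ ux))         = source-out q kq (from-u ux) rx
    not-adj (inj₂ (inj₂ (c , xc , uc))) =
      x≢u (toℕ-injective (trans x≡ (trans (cong suc (shared-out⇒same-source kp kq p<N q<N (from-x xc) (from-u uc))) (sym u≡))))

  mids-adjacent : ∀ {u v} → 2 ≤ elim-rank u → 2 ≤ elim-rank v → u ≢ v → P example u v
  mids-adjacent {u} {v} ru rv u≢v =
    u≢v , inj₂ (inj₂ (Fin.zero , step⇒arc u Fin.zero (hub-step (toℕ u) ru) , step⇒arc v Fin.zero (hub-step (toℕ v) rv)))

  eliminable : ∀ {x u v} → P example x u → P example x v → u ≢ v →
    elim-rank x ≤ elim-rank u → elim-rank x ≤ elim-rank v → P example u v
  eliminable {x} {u} {v} xu xv u≢v x≤u x≤v with elim-rank x in rx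
  ... | 0 = u≢v , inj₂ (inj₂ (x , P-at-terminal example no-out xu , P-at-terminal example no-out xv))
    where
    no-out : ∀ y → ¬ Arc example x y
    no-out y = terminal (toℕ x) rx ∘ arc⇒step x y
  ... | 1 = mids-adjacent (above-source xu x≤u) (above-source xv x≤v) u≢v
    where
    above-source : ∀ {y} → P example x y → 1 ≤ elim-rank y → 2 ≤ elim-rank y
    above-source xy 1≤y = ≤∧≢⇒< 1≤y (λ ry → sources-not-adjacent rx (sym ry) xy)
  ... | 2 = mids-adjacent x≤u x≤v u≢v
  ... | suc (suc (suc _)) =
    contradiction (elim-rankℕ≤2 (toℕ x)) (<⇒≱ (≤-trans (s≤s (s≤s (s≤s z≤n))) (≤-reflexive (sym rx))))

part2 : (i : ℕ) → 2 ≤ i →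
  Σ ℕ λ n → Σ (Digraph n) λ D → IsIJDigraph i 2 D ×
    Σ (Fin (3 * i) → Fin n) λ H → IsHole (U D) (3 * i) H × ¬ InducedContainsHole (P D) H
part2 i 2≤i = suc N , example , (acyclic , indeg≤i , outdeg≤2) , Fin.suc , hole ,
  λ (_ , W , hole′ , _) → no-hole elim-rank eliminable W hole′
  where open Construction i 2≤i

theorem1p1 :
    ((i : ℕ) → 1 ≤ i → (n : ℕ) → (D : Digraph n) → IsIJDigraph i 2 D →
      (l : ℕ) → (H : Fin l → Fin n) → IsHole (U D) l H → 3 * i + 1 ≤ l →
      InducedContainsHole (P D) H)
    ×
    ((i : ℕ) → 2 ≤ i →
      Σ ℕ λ n → Σ (Digraph n) λ D → IsIJDigraph i 2 D ×
        Σ (Fin (3 * i) → Fin n) λ H → IsHole (U D) (3 * i) H × ¬ InducedContainsHole (P D) H)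
theorem1p1 = part1 , part2
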